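{- Let $M$ be a matroid on ground set $E=[n]$ and $F$ a facet of $P(M)$. There is a subset $S\subseteq E$ and a constant $c$ such that $$h_{M_F}=c\cdot\big(h_M|_{x_i=1\text{ for } i\in E\setminus S}\big)_{\#}\cdot\big(h_M|_{x_i=1\text{ for } i\in S}\big)^{\#}.$$
   Context: For a matroid $M$ with bases $\mathcal{B}$, $h_M=\sum_{B\in\mathcal{B}}\prod_{i\in B}x_i$ and $P(M)=\operatorname{conv}\{\sum_{i\in B}e_i: B\in\mathcal{B}\}$. Every nonempty face $F$ of $P(M)$ is the matroid polytope of a uniquely determined matroid $M_F$ on $E$. For a polynomial $f$, $f^{\#}$ is the sum of its terms of largest degree and $f_{\#}$ the sum of its terms of lowest degree. -}

module Defs where

open import Data.Bool using (Bool; true; false; not; _∧_; _∨_; if_then_else_; T)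
open import Data.Nat as ℕ using (ℕ; zero; suc; _⊔_; _⊓_)
open import Data.Fin using (Fin; zero; suc)
open import Data.Fin.Subset using (Subset; inside; outside; _∈_; _∉_)
open import Data.Vec as Vec using (Vec; []; _∷_; lookup; tabulate; _[_]≔_; zipWith)
open import Data.Vec.Properties using (≡-dec)
open import Data.List as List using (List; []; _∷_; map; filter; concatMap; foldr)
open import Data.Product using (Σ; ∃; ∃-syntax; _×_; _,_; proj₁; proj₂; map₁; map₂)
open import Data.Rational as ℚ using (ℚ; 0ℚ; 1ℚ; _≤_)
open import Data.Rational.Properties as ℚP using ()
open import Relation.Nullary using (¬_; Dec; yes; no)
open import Relation.Nullary.Decidable using (⌊_⌋)
open import Relation.Binary.PropositionalEquality using (_≡_)

sumFin : ∀ k → (Fin k → ℚ) → ℚ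
sumFin zero    f = 0ℚ
sumFin (suc k) f = f zero ℚ.+ sumFin k (λ i → f (suc i))

subsets : ∀ n → List (Subset n)
subsets zero    = [] ∷ []
subsets (suc n) = map (inside ∷_) (subsets n) List.++ map (outside ∷_) (subsets n)

record Matroid (n : ℕ) : Set where
  field
    isBasis  : Subset n → Bool
    nonempty : ∃[ B ] T (isBasis B)
    exchange : ∀ B₁ B₂ → T (isBasis B₁) → T (isBasis B₂) →
               ∀ i → i ∈ B₁ → i ∉ B₂ →
               ∃[ j ] (j ∈ B₂ × j ∉ B₁ × T (isBasis ((B₁ [ i ]≔ outside) [ j ]≔ inside)))
open Matroid public

-- Geometry of the matroid polytope P(M) ⊆ ℚⁿ (vertices: indicator vectors)

indic : ∀ {n} → Subset n → Fin n → ℚ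
indic B i = if lookup B i then 1ℚ else 0ℚ

dot : ∀ {n} → (Fin n → ℚ) → Subset n → ℚ
dot {n} w B = sumFin n (λ i → w i ℚ.* indic B i)

maximises : ∀ {n} → Matroid n → (Fin n → ℚ) → Subset n → Bool
maximises {n} M w B = foldr _∧_ true (map (λ B' → not (isBasis M B') ∨ ⌊ dot w B' ℚ.≤? dot w B ⌋) (subsets n))

-- bases of M_F, where F is the face of P(M) on which w is maximised
-- (its vertices are exactly e_B for these B)
isBasisFace : ∀ {n} → Matroid n → (Fin n → ℚ) → Subset n → Bool
isBasisFace M w B = isBasis M B ∧ maximises M w B

AffIndep : ∀ {n k} → (Fin k → Subset n) → Set
AffIndep {n} {k} p =
  ∀ (λs : Fin k → ℚ) →
  (∀ j → sumFin k (λ i → λs i ℚ.* indic (p i) j) ≡ 0ℚ) →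
  sumFin k λs ≡ 0ℚ →
  ∀ i → λs i ≡ 0ℚ

-- the convex hull of {e_B : T (V B)} has (affine) dimension d
HasDim : ∀ {n} → (Subset n → Bool) → ℕ → Set
HasDim {n} V d =
  (∃[ p ] ((∀ i → T (V (p i))) × AffIndep {n} {suc d} p)) ×
  ¬ (∃[ p ] ((∀ i → T (V (p i))) × AffIndep {n} {suc (suc d)} p))

-- the face of P(M) maximising w is a facet: dim F = dim P(M) - 1
IsFacet : ∀ {n} → Matroid n → (Fin n → ℚ) → Set
IsFacet M w = ∃[ d ] (HasDim (isBasis M) (suc d) × HasDim (isBasisFace M w) d)

Mono : ℕ → Set
Mono n = Vec ℕ n

Poly : ℕ → Set
Poly n = List (ℚ × Mono n)

coeff : ∀ {n} → Poly n → Mono n → ℚ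
coeff [] α = 0ℚ
coeff ((c , β) ∷ p) α with ≡-dec ℕ._≟_ β α
... | yes _ = c ℚ.+ coeff p α
... | no  _ = coeff p α

_≈P_ : ∀ {n} → Poly n → Poly n → Set
p ≈P q = ∀ α → coeff p α ≡ coeff q α

deg : ∀ {n} → Mono n → ℕ
deg = Vec.foldr _ ℕ._+_ 0

scale : ∀ {n} → ℚ → Poly n → Poly n
scale c = map (map₁ (c ℚ.*_))

_·P_ : ∀ {n} → Poly n → Poly n → Poly n
p ·P q = concatMap (λ t → map (λ s → (proj₁ t ℚ.* proj₁ s , zipWith ℕ._+_ (proj₂ t) (proj₂ s))) q) p

-- substitute x_i = 1 for all i ∈ T
subst1 : ∀ {n} → Subset n → Poly n → Poly n
subst1 T = map (map₂ (λ α → tabulate (λ i → if lookup T i then 0 else lookup α i)))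

homog : ∀ {n} → ℕ → Poly n → Poly n
homog d = filter (λ t → deg (proj₂ t) ℕ.≟ d)

degrees : ∀ {n} → Poly n → List ℕ
degrees p = map (λ t → deg (proj₂ t)) (filter (λ t → ¬? (coeff p (proj₂ t) ℚ.≟ 0ℚ)) p)
  where open import Relation.Nullary.Decidable using (¬?)

-- f^# : terms of largest degree
top : ∀ {n} → Poly n → Poly n
top p with degrees p
... | []     = []
... | d ∷ ds = homog (foldr _⊔_ d ds) p

-- f_# : terms of lowest degree
low : ∀ {n} → Poly n → Poly n
low p with degrees p
... | []     = []
... | d ∷ ds = homog (foldr _⊓_ d ds) p

basisPoly : ∀ {n} → (Subset n → Bool) → Poly n
basisPoly {n} V =
  map (λ B → (1ℚ , Vec.map (λ b → if b then 1 else 0) B)) (filter (λ B → T? (V B)) (subsets n))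
  where open import Relation.Nullary.Decidable using () renaming (T? to T?)

h : ∀ {n} → Matroid n → Poly n
h M = basisPoly (isBasis M)

hFace : ∀ {n} → Matroid n → (Fin n → ℚ) → Poly n
hFace M w = basisPoly (isBasisFace M w)

module Submission where

-- Let w be maximised on the facet F. Exchanging, one element at a time, a basis off F towards a basis
-- on F, the first exchange landing on F swaps i for j with w i < w j, so the bases do not all meet
-- U = {k : w k ≥ w j} equally often. If a basis X meeting U maximally were off F, the functionals w
-- and 1_U would make X, a basis meeting U less, and d + 1 independent vertices of F into d + 3
-- affinely independent vertices of the (d + 1)-dimensional P(M). So the bases of M_F are the bases
-- meeting U maximally; these are closed under splicing their parts inside and outside U, so h_{M_F}
-- is, up to the number of ways of splicing a given basis, the product of the generating polynomial
-- of the parts outside U (the lowest terms of h_M with x_i = 1 on U) and of the parts inside U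
-- (the top terms of h_M with x_i = 1 off U). That number does not depend on the basis: translating
-- pairs by the symmetric difference of two bases, split along U, is a bijection.

open import Data.Bool as Bool using (Bool; true; false; not; _∧_; _∨_; _xor_; if_then_else_; T)
import Data.Bool.Properties as BoolP
open import Data.Fin as Fin using (Fin; zero; suc)
import Data.Fin.Properties as FinP
open import Data.Fin.Subset using (Subset; ∁) renaming (⊥ to ∅)
open import Data.List as List using (List; []; _∷_; map; foldr; filter; concatMap; _++_)
open import Data.List.Membership.Propositional using (_∈_)
open import Data.List.Membership.Propositional.Properties
  using (∈-map⁺; ∈-map⁻; ∈-++⁺ˡ; ∈-++⁺ʳ; ∈-filter⁺; ∈-filter⁻; foldr-selective)
import Data.List.Properties as ListP
import Data.List.Relation.Unary.All as All
import Data.List.Relation.Unary.All.Properties as AllP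
open import Data.List.Relation.Unary.Any using (here; there)
open import Data.Nat as ℕ using (ℕ; zero; suc; _+_; _≤_; _<_; _⊔_; _⊓_; s≤s)
import Data.Nat.Properties as ℕP
open import Data.Product using (∃-syntax; _×_; _,_; proj₁; proj₂; map₁)
open import Data.Rational as ℚ using (ℚ; 0ℚ; 1ℚ)
import Data.Rational.Properties as ℚP
open import Data.Rational.Solver using (module +-*-Solver)
open import Data.Sum using (_⊎_; inj₁; inj₂)
open import Data.Unit using (tt)
open import Data.Vec as Vec using (Vec; []; _∷_; lookup; tabulate; zipWith; _[_]≔_)
import Data.Vec.Functional as VF
import Data.Vec.Properties as VecP
open import Data.Vec.Relation.Binary.Pointwise.Extensional using (ext; extensional⇒inductive)
open import Data.Vec.Relation.Binary.Pointwise.Inductive using (Pointwise-≡⇒≡)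
open import Function using (_∘_)
open import Function.Bundles using (Equivalence; _⇔_; mk⇔)
open import Function.Construct.Composition using (_⇔-∘_)
open import Relation.Binary.PropositionalEquality
open import Relation.Nullary using (¬_; Dec; yes; no; does; contradiction)
open import Relation.Nullary.Decidable using (¬?; T?; ⌊_⌋; toWitness; fromWitness; dec-true; dec-false; isYes≗does)

open import Algebra.Properties.CommutativeSemigroup ℕP.+-commutativeSemigroup using () renaming (x∙yz≈y∙xz to +-left-comm)
open import Algebra.Properties.Group ℚP.+-0-group using (x∙y⁻¹≈ε⇒x≈y)

open import Defs

variable
  n k : ℕ

separated-by : (P : Fin n → Bool) {k l : Fin n} → P k ≡ true → P l ≡ false → k ≢ l
separated-by P Pk Pl refl = BoolP.not-¬ Pk Pl

does-≡ : {P : Set} (P? : Dec P) (b : Bool) → P ⇔ (b ≡ true) → does P? ≡ b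
does-≡ (yes p) true  P⇔b = refl
does-≡ (yes p) false P⇔b = sym (Equivalence.to P⇔b p)
does-≡ (no ¬p) true  P⇔b = contradiction (Equivalence.from P⇔b refl) ¬p
does-≡ (no ¬p) false P⇔b = refl

+-≡⇒≤⇔≥ : {a b c d : ℕ} → a + b ≡ c + d → (b ≤ d ⇔ c ≤ a)
+-≡⇒≤⇔≥ {a} {b} {c} {d} e = mk⇔
  (λ b≤d → ℕP.+-cancelʳ-≤ d c a (ℕP.≤-trans (ℕP.≤-reflexive (sym e)) (ℕP.+-monoʳ-≤ a b≤d)))
  (λ c≤a → ℕP.+-cancelˡ-≤ a b d (ℕP.≤-trans (ℕP.≤-reflexive e) (ℕP.+-monoˡ-≤ d c≤a)))

xor-cancelʳ : ∀ x y → (x xor y) xor y ≡ x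
xor-cancelʳ true  true  = refl
xor-cancelʳ true  false = refl
xor-cancelʳ false true  = refl
xor-cancelʳ false false = refl

iverson : Bool → ℕ
iverson true  = 1
iverson false = 0

count : (Fin n → Bool) → ℕ
count {zero}  P = 0
count {suc n} P = iverson (P zero) + count (P ∘ suc)

_⊆ᵇ_ : (P Q : Fin n → Bool) → Set
P ⊆ᵇ Q = ∀ i → P i ≡ true → Q i ≡ true

count-cong : {P Q : Fin n → Bool} → (∀ i → P i ≡ Q i) → count P ≡ count Q
count-cong {zero}  P≗Q = refl
count-cong {suc n} P≗Q = cong₂ _+_ (cong iverson (P≗Q zero)) (count-cong (P≗Q ∘ suc))

count-split : (P Q : Fin n → Bool) →
              count P ≡ count (λ i → P i ∧ Q i) + count (λ i → P i ∧ not (Q i))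
count-split {zero}  P Q = refl
count-split {suc n} P Q =
  trans (cong (iverson (P zero) +_) (count-split (P ∘ suc) (Q ∘ suc))) (split-head (P zero) (Q zero))
  where
  split-head : ∀ p q {a b} → iverson p + (a + b) ≡ (iverson (p ∧ q) + a) + (iverson (p ∧ not q) + b)
  split-head false q             = refl
  split-head true  true          = refl
  split-head true  false {a} {b} = sym (ℕP.+-suc a b)

count≡0⇒false : {P : Fin n → Bool} → count P ≡ 0 → ∀ i → P i ≡ false
count≡0⇒false {suc n} {P} e i with P zero in eq
count≡0⇒false {suc n} {P} e zero    | false = eq
count≡0⇒false {suc n} {P} e (suc i) | false = count≡0⇒false {P = P ∘ suc} e i

count≢0⇒true : {P : Fin n → Bool} → count P ≢ 0 → ∃[ i ] P i ≡ true
count≢0⇒true {zero}      ne = contradiction refl ne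
count≢0⇒true {suc n} {P} ne with P zero in eq
... | true  = zero , eq
... | false = let (i , Pi) = count≢0⇒true {P = P ∘ suc} ne in suc i , Pi

count-⊆ᵇ-∖≡0 : {P Q : Fin n → Bool} → P ⊆ᵇ Q → count P ≡ count Q → count (λ i → Q i ∧ not (P i)) ≡ 0
count-⊆ᵇ-∖≡0 {P = P} {Q} P⊆Q eq = ℕP.+-cancelˡ-≡ (count P) _ 0 (begin
  count P + count (λ i → Q i ∧ not (P i))                 ≡⟨ cong (_+ count (λ i → Q i ∧ not (P i))) (count-cong Q∧P≗P) ⟨
  count (λ i → Q i ∧ P i) + count (λ i → Q i ∧ not (P i)) ≡⟨ count-split Q P ⟨
  count Q                                                 ≡⟨ eq ⟨
  count P                                                 ≡⟨ ℕP.+-identityʳ _ ⟨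
  count P + 0                                             ∎)
  where
  open ≡-Reasoning
  Q∧P≗P : ∀ i → Q i ∧ P i ≡ P i
  Q∧P≗P i with P i in Pi
  ... | true  = cong (_∧ true) (P⊆Q i Pi)
  ... | false = BoolP.∧-zeroʳ (Q i)

count-⊆ᵇ-≡ : {P Q : Fin n → Bool} → P ⊆ᵇ Q → count P ≡ count Q → ∀ i → P i ≡ Q i
count-⊆ᵇ-≡ {P = P} {Q} P⊆Q eq i with P i in Pi | Q i in Qi | count≡0⇒false (count-⊆ᵇ-∖≡0 P⊆Q eq) i
... | true  | true  | _ = refl
... | false | false | _ = refl
... | true  | false | _ = trans (sym (P⊆Q i Pi)) Qi
... | false | true  | ()

count-remove : {P P′ : Fin n → Bool} (i : Fin n) → (∀ k → k ≢ i → P k ≡ P′ k) → P′ i ≡ false →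
               count P ≡ iverson (P i) + count P′
count-remove {suc n} {P} zero    P≗P′ P′i≡false rewrite P′i≡false =
  cong (iverson (P zero) +_) (count-cong (λ k → P≗P′ (suc k) λ ()))
count-remove {suc n} {P} {P′} (suc i) P≗P′ P′i≡false = begin
  iverson (P zero) + count (P ∘ suc)                      ≡⟨ cong₂ _+_ (cong iverson (P≗P′ zero λ ())) tail-eq ⟩
  iverson (P′ zero) + (iverson (P (suc i)) + count (P′ ∘ suc)) ≡⟨ +-left-comm (iverson (P′ zero)) (iverson (P (suc i))) _ ⟩
  iverson (P (suc i)) + (iverson (P′ zero) + count (P′ ∘ suc)) ∎
  where
  open ≡-Reasoning
  tail-eq : count (P ∘ suc) ≡ iverson (P (suc i)) + count (P′ ∘ suc)
  tail-eq = count-remove i (λ k k≢i → P≗P′ (suc k) (k≢i ∘ FinP.suc-injective)) P′i≡false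

lookup-ext : {A : Set} {xs ys : Vec A n} → (∀ i → lookup xs i ≡ lookup ys i) → xs ≡ ys
lookup-ext = Pointwise-≡⇒≡ ∘ extensional⇒inductive ∘ ext

∈-subsets : (X : Subset n) → X ∈ subsets n
∈-subsets []          = here refl
∈-subsets (true ∷ X)  = ∈-++⁺ˡ (∈-map⁺ (true ∷_) (∈-subsets X))
∈-subsets (false ∷ X) = ∈-++⁺ʳ _ (∈-map⁺ (false ∷_) (∈-subsets X))

_≟ˢ_ : (X Y : Subset n) → Dec (X ≡ Y)
_≟ˢ_ = VecP.≡-dec Bool._≟_

size : Subset n → ℕ
size Y = count (lookup Y)

∣_∩_∣ : (Fin n → Bool) → Subset n → ℕ
∣ Q ∩ Y ∣ = count (λ k → Q k ∧ lookup Y k)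

_⟨_⇄_⟩ : Subset n → Fin n → Fin n → Subset n
Y ⟨ i ⇄ j ⟩ = (Y [ i ]≔ false) [ j ]≔ true

lookup-⇄-new : (Y : Subset n) (i j : Fin n) → lookup (Y ⟨ i ⇄ j ⟩) j ≡ true
lookup-⇄-new Y i j = VecP.lookup∘update j (Y [ i ]≔ false) true

lookup-⇄-other : (Y : Subset n) {i j k : Fin n} → k ≢ i → k ≢ j → lookup (Y ⟨ i ⇄ j ⟩) k ≡ lookup Y k
lookup-⇄-other Y {i} k≢i k≢j = trans (VecP.lookup∘update′ k≢j (Y [ i ]≔ false) true) (VecP.lookup∘update′ k≢i Y false)

∣∩∣≡0⇒disjoint : (Q : Fin n → Bool) (Y : Subset n) → ∣ Q ∩ Y ∣ ≡ 0 → ∀ i → lookup Y i ≡ true → Q i ≡ false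
∣∩∣≡0⇒disjoint Q Y e i Yi with Q i in Qi
... | false = refl
... | true  = contradiction (trans (cong₂ _∧_ (sym Qi) (sym Yi)) (count≡0⇒false e i)) λ ()

∣∩∣≡suc⇒∃ : (Q : Fin n → Bool) (Y : Subset n) → ∣ Q ∩ Y ∣ ≡ suc k → ∃[ i ] Q i ≡ true × lookup Y i ≡ true
∣∩∣≡suc⇒∃ Q Y e =
  let (i , Q∧Y) = count≢0⇒true (λ e₀ → ℕP.1+n≢0 (trans (sym e) e₀))
  in i , BoolP.∧-conicalˡ (Q i) _ Q∧Y , BoolP.∧-conicalʳ (Q i) _ Q∧Y

disjoint-or-meets : (Q : Fin n → Bool) (Y : Subset n) →
                    (∀ i → lookup Y i ≡ true → Q i ≡ false) ⊎ ∃[ i ] Q i ≡ true × lookup Y i ≡ true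
disjoint-or-meets Q Y with ∣ Q ∩ Y ∣ in e
... | zero  = inj₁ (∣∩∣≡0⇒disjoint Q Y e)
... | suc _ = inj₂ (∣∩∣≡suc⇒∃ Q Y e)

∣∩∣+∣∁∩∣≡size : (U : Fin n → Bool) (Y : Subset n) → ∣ U ∩ Y ∣ + ∣ not ∘ U ∩ Y ∣ ≡ size Y
∣∩∣+∣∁∩∣≡size U Y = sym (trans (count-split (lookup Y) U)
  (cong₂ _+_ (count-cong (λ i → BoolP.∧-comm (lookup Y i) (U i))) (count-cong (λ i → BoolP.∧-comm (lookup Y i) (not (U i))))))

agree-outside⇒∣∩∣≡ : (U : Fin n → Bool) (X Y : Subset n) → size X ≡ size Y →
                      (∀ i → U i ≡ false → lookup X i ≡ lookup Y i) → ∣ U ∩ X ∣ ≡ ∣ U ∩ Y ∣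
agree-outside⇒∣∩∣≡ U X Y ∣X∣≡∣Y∣ X≗Y = ℕP.+-cancelʳ-≡ ∣ not ∘ U ∩ Y ∣ _ _ (begin
  ∣ U ∩ X ∣ + ∣ not ∘ U ∩ Y ∣ ≡⟨ cong (∣ U ∩ X ∣ +_) (count-cong outside-eq) ⟨
  ∣ U ∩ X ∣ + ∣ not ∘ U ∩ X ∣ ≡⟨ ∣∩∣+∣∁∩∣≡size U X ⟩
  size X                      ≡⟨ ∣X∣≡∣Y∣ ⟩
  size Y                      ≡⟨ ∣∩∣+∣∁∩∣≡size U Y ⟨
  ∣ U ∩ Y ∣ + ∣ not ∘ U ∩ Y ∣ ∎)
  where
  open ≡-Reasoning
  outside-eq : ∀ i → not (U i) ∧ lookup X i ≡ not (U i) ∧ lookup Y i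
  outside-eq i with U i in Ui
  ... | true  = refl
  ... | false = X≗Y i Ui

∣∩∣-remove : (Q : Fin n → Bool) (Y : Subset n) (i : Fin n) → lookup Y i ≡ true →
             ∣ Q ∩ Y ∣ ≡ iverson (Q i) + ∣ Q ∩ Y [ i ]≔ false ∣
∣∩∣-remove Q Y i Yi =
  trans (count-remove i (λ k k≢i → cong (Q k ∧_) (sym (VecP.lookup∘update′ k≢i Y false)))
                        (trans (cong (Q i ∧_) (VecP.lookup∘update i Y false)) (BoolP.∧-zeroʳ (Q i))))
        (cong (λ b → iverson b + ∣ Q ∩ Y [ i ]≔ false ∣) (trans (cong (Q i ∧_) Yi) (BoolP.∧-identityʳ (Q i))))

∣∩∣-insert : (Q : Fin n → Bool) (Z : Subset n) (j : Fin n) → lookup Z j ≡ false →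
             ∣ Q ∩ Z [ j ]≔ true ∣ ≡ iverson (Q j) + ∣ Q ∩ Z ∣
∣∩∣-insert Q Z j Zj =
  trans (count-remove j (λ k k≢j → cong (Q k ∧_) (VecP.lookup∘update′ k≢j Z true))
                        (trans (cong (Q j ∧_) Zj) (BoolP.∧-zeroʳ (Q j))))
        (cong (λ b → iverson b + ∣ Q ∩ Z ∣) (trans (cong (Q j ∧_) (VecP.lookup∘update j Z true)) (BoolP.∧-identityʳ (Q j))))

∣∩∣-⇄ : (Q : Fin n → Bool) (Y : Subset n) (i j : Fin n) → lookup Y i ≡ true → lookup Y j ≡ false →
        ∣ Q ∩ Y ⟨ i ⇄ j ⟩ ∣ + iverson (Q i) ≡ ∣ Q ∩ Y ∣ + iverson (Q j)
∣∩∣-⇄ {n} Q Y i j Yi Yj = begin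
  ∣ Q ∩ Y ⟨ i ⇄ j ⟩ ∣ + iverson (Q i)       ≡⟨ cong (_+ iverson (Q i)) (∣∩∣-insert Q Z j Zj) ⟩
  iverson (Q j) + ∣ Q ∩ Z ∣ + iverson (Q i) ≡⟨ ℕP.+-assoc (iverson (Q j)) _ _ ⟩
  iverson (Q j) + (∣ Q ∩ Z ∣ + iverson (Q i)) ≡⟨ cong (iverson (Q j) +_) (ℕP.+-comm ∣ Q ∩ Z ∣ _) ⟩
  iverson (Q j) + (iverson (Q i) + ∣ Q ∩ Z ∣) ≡⟨ cong (iverson (Q j) +_) (∣∩∣-remove Q Y i Yi) ⟨
  iverson (Q j) + ∣ Q ∩ Y ∣                 ≡⟨ ℕP.+-comm (iverson (Q j)) _ ⟩
  ∣ Q ∩ Y ∣ + iverson (Q j)                 ∎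
  where
  open ≡-Reasoning
  Z : Subset n
  Z = Y [ i ]≔ false
  Zj : lookup Z j ≡ false
  Zj with i Fin.≟ j
  ... | yes refl = VecP.lookup∘update i Y false
  ... | no  i≢j  = trans (VecP.lookup∘update′ (i≢j ∘ sym) Y false) Yj

∣∩∣-⇄-↓ : (Q : Fin n → Bool) (Y : Subset n) (i j : Fin n) → lookup Y i ≡ true → lookup Y j ≡ false →
          Q i ≡ true → Q j ≡ false → suc ∣ Q ∩ Y ⟨ i ⇄ j ⟩ ∣ ≡ ∣ Q ∩ Y ∣
∣∩∣-⇄-↓ Q Y i j Yi Yj Qi Qj = begin
  suc ∣ Q ∩ Y ⟨ i ⇄ j ⟩ ∣              ≡⟨ ℕP.+-comm 1 _ ⟩
  ∣ Q ∩ Y ⟨ i ⇄ j ⟩ ∣ + iverson true    ≡⟨ cong (λ q → ∣ Q ∩ Y ⟨ i ⇄ j ⟩ ∣ + iverson q) Qi ⟨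
  ∣ Q ∩ Y ⟨ i ⇄ j ⟩ ∣ + iverson (Q i)   ≡⟨ ∣∩∣-⇄ Q Y i j Yi Yj ⟩
  ∣ Q ∩ Y ∣ + iverson (Q j)             ≡⟨ cong (λ q → ∣ Q ∩ Y ∣ + iverson q) Qj ⟩
  ∣ Q ∩ Y ∣ + 0                         ≡⟨ ℕP.+-identityʳ _ ⟩
  ∣ Q ∩ Y ∣                             ∎
  where open ≡-Reasoning

∣∩∣-⇄-↑ : (Q : Fin n → Bool) (Y : Subset n) (i j : Fin n) → lookup Y i ≡ true → lookup Y j ≡ false →
          Q i ≡ false → Q j ≡ true → ∣ Q ∩ Y ⟨ i ⇄ j ⟩ ∣ ≡ suc ∣ Q ∩ Y ∣
∣∩∣-⇄-↑ Q Y i j Yi Yj Qi Qj = begin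
  ∣ Q ∩ Y ⟨ i ⇄ j ⟩ ∣                   ≡⟨ ℕP.+-identityʳ _ ⟨
  ∣ Q ∩ Y ⟨ i ⇄ j ⟩ ∣ + iverson false   ≡⟨ cong (λ q → ∣ Q ∩ Y ⟨ i ⇄ j ⟩ ∣ + iverson q) Qi ⟨
  ∣ Q ∩ Y ⟨ i ⇄ j ⟩ ∣ + iverson (Q i)   ≡⟨ ∣∩∣-⇄ Q Y i j Yi Yj ⟩
  ∣ Q ∩ Y ∣ + iverson (Q j)             ≡⟨ cong (λ q → ∣ Q ∩ Y ∣ + iverson q) Qj ⟩
  ∣ Q ∩ Y ∣ + 1                         ≡⟨ ℕP.+-comm _ 1 ⟩
  suc ∣ Q ∩ Y ∣                         ∎
  where open ≡-Reasoning

∣∩∣-⇄-≡ : (Q : Fin n → Bool) (Y : Subset n) (i j : Fin n) → lookup Y i ≡ true → lookup Y j ≡ false →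
          Q i ≡ Q j → ∣ Q ∩ Y ⟨ i ⇄ j ⟩ ∣ ≡ ∣ Q ∩ Y ∣
∣∩∣-⇄-≡ Q Y i j Yi Yj Qi≡Qj =
  ℕP.+-cancelʳ-≡ (iverson (Q i)) _ _ (trans (∣∩∣-⇄ Q Y i j Yi Yj) (cong (λ q → ∣ Q ∩ Y ∣ + iverson q) (sym Qi≡Qj)))

∣∩∣-⇄-≥ : (Q : Fin n → Bool) (Y : Subset n) (i j : Fin n) → lookup Y i ≡ true → lookup Y j ≡ false →
          Q i ≡ false → ∣ Q ∩ Y ∣ ≤ ∣ Q ∩ Y ⟨ i ⇄ j ⟩ ∣
∣∩∣-⇄-≥ Q Y i j Yi Yj Qi = begin
  ∣ Q ∩ Y ∣                           ≤⟨ ℕP.m≤m+n _ _ ⟩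
  ∣ Q ∩ Y ∣ + iverson (Q j)           ≡⟨ ∣∩∣-⇄ Q Y i j Yi Yj ⟨
  ∣ Q ∩ Y ⟨ i ⇄ j ⟩ ∣ + iverson (Q i) ≡⟨ cong (λ q → ∣ Q ∩ Y ⟨ i ⇄ j ⟩ ∣ + iverson q) Qi ⟩
  ∣ Q ∩ Y ⟨ i ⇄ j ⟩ ∣ + 0             ≡⟨ ℕP.+-identityʳ _ ⟩
  ∣ Q ∩ Y ⟨ i ⇄ j ⟩ ∣                 ∎
  where open ℕP.≤-Reasoning

module _ (M : Matroid n) where

  IsBasis : Subset n → Set
  IsBasis B = isBasis M B ≡ true

  basis-exchange : {B₁ B₂ : Subset n} → IsBasis B₁ → IsBasis B₂ →
                   ∀ i → lookup B₁ i ≡ true → lookup B₂ i ≡ false →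
                   ∃[ j ] lookup B₂ j ≡ true × lookup B₁ j ≡ false × IsBasis (B₁ ⟨ i ⇄ j ⟩)
  basis-exchange {B₁} {B₂} b₁ b₂ i B₁i B₂i =
    let (j , j∈B₂ , j∉B₁ , b) = exchange M B₁ B₂ (from BoolP.T-≡ b₁) (from BoolP.T-≡ b₂) i
                                   (VecP.lookup⇒[]= i B₁ B₁i) (λ i∈B₂ → BoolP.not-¬ (VecP.[]=⇒lookup i∈B₂) B₂i)
    in j , VecP.[]=⇒lookup j∈B₂ , BoolP.¬-not (j∉B₁ ∘ VecP.lookup⇒[]= j B₁) , to BoolP.T-≡ b
    where open Equivalence

  bases-⊆⇒≡ : {B₁ B₂ : Subset n} → IsBasis B₁ → IsBasis B₂ → lookup B₁ ⊆ᵇ lookup B₂ → ∀ i → lookup B₁ i ≡ lookup B₂ i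
  bases-⊆⇒≡ {B₁} {B₂} b₁ b₂ B₁⊆B₂ i with lookup B₁ i in B₁i | lookup B₂ i in B₂i
  ... | true  | true  = refl
  ... | false | false = refl
  ... | true  | false = trans (sym (B₁⊆B₂ i B₁i)) B₂i
  ... | false | true  =
    let (j , B₁j , B₂j , _) = basis-exchange b₂ b₁ i B₂i B₁i in contradiction (B₁⊆B₂ j B₁j) (BoolP.not-¬ B₂j)

  bases-equicardinal : {B₁ B₂ : Subset n} → IsBasis B₁ → IsBasis B₂ → size B₁ ≡ size B₂
  bases-equicardinal = go _ refl
    where
    go : ∀ m {B₁ B₂} → ∣ not ∘ lookup B₂ ∩ B₁ ∣ ≡ m → IsBasis B₁ → IsBasis B₂ → size B₁ ≡ size B₂
    go zero {B₁} {B₂} e b₁ b₂ =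
      count-cong (bases-⊆⇒≡ b₁ b₂ (λ i B₁i → BoolP.not-injective (∣∩∣≡0⇒disjoint (not ∘ lookup B₂) B₁ e i B₁i)))
    go (suc m) {B₁} {B₂} e b₁ b₂ =
      let (i , B₂i , B₁i) = ∣∩∣≡suc⇒∃ (not ∘ lookup B₂) B₁ e
          (j , B₂j , B₁j , b) = basis-exchange b₁ b₂ i B₁i (BoolP.not-injective B₂i)
      in trans (sym (∣∩∣-⇄-≡ (λ _ → true) B₁ i j B₁i B₁j refl))
               (go m (ℕP.suc-injective (trans (∣∩∣-⇄-↓ (not ∘ lookup B₂) B₁ i j B₁i B₁j B₂i (cong not B₂j)) e)) b b₂)

iversonℚ : Bool → ℚ
iversonℚ b = if b then 1ℚ else 0ℚ

sumFin-cong : ∀ k {f g : Fin k → ℚ} → (∀ i → f i ≡ g i) → sumFin k f ≡ sumFin k g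
sumFin-cong zero    f≗g = refl
sumFin-cong (suc k) f≗g = cong₂ ℚ._+_ (f≗g zero) (sumFin-cong k (f≗g ∘ suc))

sumFin-exchange : ∀ k {f g : Fin k → ℚ} (i : Fin k) → (∀ m → m ≢ i → f m ≡ g m) →
                  sumFin k f ℚ.+ g i ≡ sumFin k g ℚ.+ f i
sumFin-exchange (suc k) {f} {g} zero f≗g =
  trans (cong (λ s → f zero ℚ.+ s ℚ.+ g zero) (sumFin-cong k (λ m → f≗g (suc m) λ ())))
        (solve 3 (λ a b c → (a :+ b) :+ c := (c :+ b) :+ a) refl (f zero) (sumFin k (g ∘ suc)) (g zero))
  where open +-*-Solver
sumFin-exchange (suc k) {f} {g} (suc i) f≗g = begin
  f zero ℚ.+ sumFin k (f ∘ suc) ℚ.+ g (suc i)   ≡⟨ ℚP.+-assoc (f zero) _ _ ⟩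
  f zero ℚ.+ (sumFin k (f ∘ suc) ℚ.+ g (suc i)) ≡⟨ cong₂ ℚ._+_ (f≗g zero λ ()) tail-eq ⟩
  g zero ℚ.+ (sumFin k (g ∘ suc) ℚ.+ f (suc i)) ≡⟨ ℚP.+-assoc (g zero) _ _ ⟨
  g zero ℚ.+ sumFin k (g ∘ suc) ℚ.+ f (suc i)   ∎
  where
  open ≡-Reasoning
  tail-eq : sumFin k (f ∘ suc) ℚ.+ g (suc i) ≡ sumFin k (g ∘ suc) ℚ.+ f (suc i)
  tail-eq = sumFin-exchange k i (λ m m≢i → f≗g (suc m) (m≢i ∘ FinP.suc-injective))

dot-differ-at : (w : Fin n → ℚ) (Y Z : Subset n) (i : Fin n) → (∀ m → m ≢ i → lookup Y m ≡ lookup Z m) →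
                lookup Y i ≡ true → lookup Z i ≡ false → dot w Y ≡ dot w Z ℚ.+ w i
dot-differ-at {n} w Y Z i Y≗Z Yi Zi = begin
  dot w Y                          ≡⟨ ℚP.+-identityʳ _ ⟨
  dot w Y ℚ.+ 0ℚ                   ≡⟨ cong (dot w Y ℚ.+_) (ℚP.*-zeroʳ (w i)) ⟨
  dot w Y ℚ.+ w i ℚ.* 0ℚ           ≡⟨ cong (λ b → dot w Y ℚ.+ w i ℚ.* iversonℚ b) Zi ⟨
  dot w Y ℚ.+ w i ℚ.* indic Z i    ≡⟨ sumFin-exchange n i (λ m m≢i → cong (λ b → w m ℚ.* iversonℚ b) (Y≗Z m m≢i)) ⟩
  dot w Z ℚ.+ w i ℚ.* indic Y i    ≡⟨ cong (λ b → dot w Z ℚ.+ w i ℚ.* iversonℚ b) Yi ⟩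
  dot w Z ℚ.+ w i ℚ.* 1ℚ           ≡⟨ cong (dot w Z ℚ.+_) (ℚP.*-identityʳ (w i)) ⟩
  dot w Z ℚ.+ w i                  ∎
  where open ≡-Reasoning

dot-⇄ : (w : Fin n → ℚ) (Y : Subset n) (i j : Fin n) → lookup Y i ≡ true → lookup Y j ≡ false →
        dot w (Y ⟨ i ⇄ j ⟩) ℚ.+ w i ≡ dot w Y ℚ.+ w j
dot-⇄ {n} w Y i j Yi Yj = begin
  dot w (Y ⟨ i ⇄ j ⟩) ℚ.+ w i   ≡⟨ cong (ℚ._+ w i) (dot-differ-at w (Y ⟨ i ⇄ j ⟩) Z j (λ m m≢j → VecP.lookup∘update′ m≢j Z true)
                                                      (lookup-⇄-new Y i j) Zj) ⟩
  dot w Z ℚ.+ w j ℚ.+ w i       ≡⟨ solve 3 (λ z a b → (z :+ a) :+ b := (z :+ b) :+ a) refl (dot w Z) (w j) (w i) ⟩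
  dot w Z ℚ.+ w i ℚ.+ w j       ≡⟨ cong (ℚ._+ w j) (dot-differ-at w Y Z i (λ m m≢i → sym (VecP.lookup∘update′ m≢i Y false))
                                                      Yi (VecP.lookup∘update i Y false)) ⟨
  dot w Y ℚ.+ w j               ∎
  where
  open ≡-Reasoning
  open +-*-Solver
  Z : Subset n
  Z = Y [ i ]≔ false
  Zj : lookup Z j ≡ false
  Zj with i Fin.≟ j
  ... | yes refl = VecP.lookup∘update i Y false
  ... | no  i≢j  = trans (VecP.lookup∘update′ (i≢j ∘ sym) Y false) Yj

+-swap-< : {x a y b : ℚ} → x ℚ.+ a ≡ y ℚ.+ b → a ℚ.< b → y ℚ.< x
+-swap-< {x} {a} {y} {b} e a<b with y ℚ.<? x
... | yes y<x = y<x
... | no  y≮x = contradiction e (ℚP.<⇒≢ (ℚP.+-mono-≤-< (ℚP.≮⇒≥ y≮x) a<b))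

module _ (M : Matroid n) (w : Fin n → ℚ) where

  IsMaximiser : Subset n → Set
  IsMaximiser B = maximises M w B ≡ true

  maximiser⇒≤ : ∀ B → IsMaximiser B → ∀ Y → IsBasis M Y → dot w Y ℚ.≤ dot w B
  maximiser⇒≤ B mB Y bY =
    toWitness (subst (λ b → T (not b ∨ ⌊ dot w Y ℚ.≤? dot w B ⌋)) bY
                     (All.lookup (AllP.all⁺ _ (subsets n) (from BoolP.T-≡ mB)) (∈-subsets Y)))
    where open Equivalence

  ≤⇒maximiser : ∀ B → (∀ Y → IsBasis M Y → dot w Y ℚ.≤ dot w B) → IsMaximiser B
  ≤⇒maximiser B B-max = to BoolP.T-≡ (AllP.all⁻ _ {xs = subsets n} (All.tabulate λ {Y} _ → pointwise Y))
    where
    open Equivalence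
    pointwise : ∀ Y → T (not (isBasis M Y) ∨ ⌊ dot w Y ℚ.≤? dot w B ⌋)
    pointwise Y with isBasis M Y in bY
    ... | false = tt
    ... | true  = fromWitness (B-max Y bY)

  non-maximiser-< : ∀ B X → IsMaximiser B → maximises M w X ≡ false → dot w X ℚ.< dot w B
  non-maximiser-< B X mB mX with dot w B ℚ.≤? dot w X
  ... | no  B≰X = ℚP.≰⇒> B≰X
  ... | yes B≤X = contradiction mX (BoolP.not-¬ (≤⇒maximiser X (λ Y bY → ℚP.≤-trans (maximiser⇒≤ B mB Y bY) B≤X)))

UpperLevelSet : (Fin n → ℚ) → (Fin n → Bool) → Set
UpperLevelSet w U = ∀ a b → U a ≡ true → U b ≡ false → w b ℚ.< w a

≥-level : (Fin n → ℚ) → ℚ → Fin n → Bool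
≥-level w t k = ⌊ t ℚ.≤? w k ⌋

≥-level-true : (w : Fin n → ℚ) (t : ℚ) (k : Fin n) → t ℚ.≤ w k → ≥-level w t k ≡ true
≥-level-true w t k t≤wk = trans (isYes≗does (t ℚ.≤? w k)) (dec-true (t ℚ.≤? w k) t≤wk)

≥-level-false : (w : Fin n → ℚ) (t : ℚ) (k : Fin n) → w k ℚ.< t → ≥-level w t k ≡ false
≥-level-false w t k wk<t =
  trans (isYes≗does (t ℚ.≤? w k)) (dec-false (t ℚ.≤? w k) (λ t≤wk → ℚP.<-irrefl refl (ℚP.<-≤-trans wk<t t≤wk)))

≥-level-upper : (w : Fin n → ℚ) (t : ℚ) → UpperLevelSet w (≥-level w t)
≥-level-upper w t a b Ua Ub =
  ℚP.<-≤-trans (ℚP.≰⇒> (λ t≤wb → BoolP.not-¬ (Equivalence.to BoolP.T-≡ (fromWitness t≤wb)) Ub))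
               (toWitness (Equivalence.from BoolP.T-≡ Ua))

module _ (M : Matroid n) where

  MaximallyMeets : (Fin n → Bool) → Subset n → Set
  MaximallyMeets U X = ∀ Y → IsBasis M Y → ∣ U ∩ Y ∣ ≤ ∣ U ∩ X ∣

  maximiser-maximally-meets : (w : Fin n → ℚ) {U : Fin n → Bool} → UpperLevelSet w U →
                              ∀ B → IsBasis M B → IsMaximiser M w B → MaximallyMeets U B
  maximiser-maximally-meets w {U} upper B bB mB B′ bB′ = ℕP.≮⇒≥ (no-better _ B′ refl bB′)
    where
    -- Exchanging out of B′ an element of B′ ∖ B outside U does not lower |U ∩ B′| and brings B′
    -- closer to B. Once B′ ∖ B ⊆ U, an element of B ∖ B′ outside U could be exchanged in B for
    -- one of U, increasing w; if there is none either, B and B′ agree outside U.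
    no-better : ∀ m B′ → ∣ not ∘ lookup B ∩ B′ ∣ ≡ m → IsBasis M B′ → ¬ (∣ U ∩ B ∣ < ∣ U ∩ B′ ∣)
    no-better m B′ e bB′ B<B′ with disjoint-or-meets (λ x → not (lookup B x) ∧ not (U x)) B′
    no-better (suc m) B′ e bB′ B<B′ | inj₂ (i , ¬Bi∧¬Ui , B′i) =
      let Bi = BoolP.not-injective (BoolP.∧-conicalˡ _ _ ¬Bi∧¬Ui)
          Ui = BoolP.not-injective (BoolP.∧-conicalʳ _ _ ¬Bi∧¬Ui)
          (j , Bj , B′j , b) = basis-exchange M bB′ bB i B′i Bi
      in no-better m (B′ ⟨ i ⇄ j ⟩)
           (ℕP.suc-injective (trans (∣∩∣-⇄-↓ (not ∘ lookup B) B′ i j B′i B′j (cong not Bi) (cong not Bj)) e)) b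
           (ℕP.<-≤-trans B<B′ (∣∩∣-⇄-≥ U B′ i j B′i B′j Ui))
    no-better zero B′ e bB′ B<B′ | inj₂ (i , ¬Bi∧¬Ui , B′i) =
      contradiction (trans (sym (BoolP.∧-conicalˡ _ _ ¬Bi∧¬Ui)) (∣∩∣≡0⇒disjoint (not ∘ lookup B) B′ e i B′i)) λ ()
    ... | inj₁ B′∖B⊆U with disjoint-or-meets (λ x → not (lookup B′ x) ∧ not (U x)) B
    ...   | inj₂ (i , ¬B′i∧¬Ui , Bi) =
      let B′i = BoolP.not-injective (BoolP.∧-conicalˡ _ _ ¬B′i∧¬Ui)
          Ui = BoolP.not-injective (BoolP.∧-conicalʳ _ _ ¬B′i∧¬Ui)
          (j , B′j , Bj , b) = basis-exchange M bB bB′ i Bi B′i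
          Uj = BoolP.not-injective (trans (sym (cong (λ b → not b ∧ not (U j)) Bj)) (B′∖B⊆U j B′j))
          B<B⇄ = +-swap-< (dot-⇄ w B i j Bi Bj) (upper j i Uj Ui)
      in ℚP.<-irrefl refl (ℚP.<-≤-trans B<B⇄ (maximiser⇒≤ M w B mB (B ⟨ i ⇄ j ⟩) b))
    ...   | inj₁ B∖B′⊆U = ℕP.<-irrefl (agree-outside⇒∣∩∣≡ U B B′ (bases-equicardinal M bB bB′) agree) B<B′
      where
      agree : ∀ i → U i ≡ false → lookup B i ≡ lookup B′ i
      agree i Ui with lookup B i in Bi | lookup B′ i in B′i
      ... | true  | true  = refl
      ... | false | false = refl
      ... | true  | false = contradiction (trans (sym (cong₂ (λ b u → not b ∧ not u) B′i Ui)) (B∖B′⊆U i Bi)) λ ()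
      ... | false | true  = contradiction (trans (sym (cong₂ (λ b u → not b ∧ not u) Bi Ui)) (B′∖B⊆U i B′i)) λ ()

sumFin-zero : ∀ k {f : Fin k → ℚ} → (∀ i → f i ≡ 0ℚ) → sumFin k f ≡ 0ℚ
sumFin-zero zero    f≗0 = refl
sumFin-zero (suc k) f≗0 = trans (cong₂ ℚ._+_ (f≗0 zero) (sumFin-zero k (f≗0 ∘ suc))) (ℚP.+-identityʳ 0ℚ)

sumFin-*ˡ : ∀ k (c : ℚ) (f : Fin k → ℚ) → c ℚ.* sumFin k f ≡ sumFin k (λ i → c ℚ.* f i)
sumFin-*ˡ zero    c f = ℚP.*-zeroʳ c
sumFin-*ˡ (suc k) c f = trans (ℚP.*-distribˡ-+ c (f zero) _) (cong (c ℚ.* f zero ℚ.+_) (sumFin-*ˡ k c (f ∘ suc)))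

sumFin-+ : ∀ k (f g : Fin k → ℚ) → sumFin k (λ i → f i ℚ.+ g i) ≡ sumFin k f ℚ.+ sumFin k g
sumFin-+ zero    f g = sym (ℚP.+-identityʳ 0ℚ)
sumFin-+ (suc k) f g =
  trans (cong (f zero ℚ.+ g zero ℚ.+_) (sumFin-+ k (f ∘ suc) (g ∘ suc)))
        (solve 4 (λ a b c d → (a :+ b) :+ (c :+ d) := (a :+ c) :+ (b :+ d)) refl (f zero) (g zero) _ _)
  where open +-*-Solver

sumFin-comm : ∀ k l (f : Fin k → Fin l → ℚ) →
              sumFin k (λ i → sumFin l (f i)) ≡ sumFin l (λ j → sumFin k (λ i → f i j))
sumFin-comm zero    l f = sym (sumFin-zero l (λ _ → refl))
sumFin-comm (suc k) l f =
  trans (cong (sumFin l (f zero) ℚ.+_) (sumFin-comm k l (f ∘ suc)))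
        (sym (sumFin-+ l (f zero) (λ j → sumFin k (λ i → f (suc i) j))))

affine-relation-dot : (p : Fin k → Subset n) (λs : Fin k → ℚ) →
                      (∀ j → sumFin k (λ i → λs i ℚ.* indic (p i) j) ≡ 0ℚ) →
                      ∀ u → sumFin k (λ i → λs i ℚ.* dot u (p i)) ≡ 0ℚ
affine-relation-dot {k} {n} p λs relation u = begin
  sumFin k (λ i → λs i ℚ.* dot u (p i))                               ≡⟨ sumFin-cong k (λ i → sumFin-*ˡ n (λs i) _) ⟩
  sumFin k (λ i → sumFin n (λ j → λs i ℚ.* (u j ℚ.* indic (p i) j)))  ≡⟨ sumFin-comm k n _ ⟩
  sumFin n (λ j → sumFin k (λ i → λs i ℚ.* (u j ℚ.* indic (p i) j)))  ≡⟨ sumFin-cong n (λ j → sumFin-cong k (λ i →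
                                                                          solve 3 (λ a b c → a :* (b :* c) := b :* (a :* c)) refl (λs i) (u j) _)) ⟩
  sumFin n (λ j → sumFin k (λ i → u j ℚ.* (λs i ℚ.* indic (p i) j)))  ≡⟨ sumFin-cong n (λ j → sumFin-*ˡ k (u j) _) ⟨
  sumFin n (λ j → u j ℚ.* sumFin k (λ i → λs i ℚ.* indic (p i) j))    ≡⟨ sumFin-zero n (λ j →
                                                                          trans (cong (u j ℚ.*_) (relation j)) (ℚP.*-zeroʳ (u j))) ⟩
  0ℚ                                                                  ∎
  where
  open ≡-Reasoning
  open +-*-Solver

*≡0⇒≡0 : (a x : ℚ) → a ℚ.* x ≡ 0ℚ → x ≢ 0ℚ → a ≡ 0ℚ
*≡0⇒≡0 a x ax≡0 x≢0 = begin
  a                       ≡⟨ ℚP.*-identityʳ a ⟨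
  a ℚ.* 1ℚ                ≡⟨ cong (a ℚ.*_) (ℚP.*-inverseʳ x) ⟨
  a ℚ.* (x ℚ.* ℚ.1/ x)    ≡⟨ ℚP.*-assoc a x _ ⟨
  a ℚ.* x ℚ.* ℚ.1/ x      ≡⟨ cong (ℚ._* ℚ.1/ x) ax≡0 ⟩
  0ℚ ℚ.* ℚ.1/ x           ≡⟨ ℚP.*-zeroˡ (ℚ.1/ x) ⟩
  0ℚ                      ∎
  where
  open ≡-Reasoning
  instance _ = ℚ.≢-nonZero x≢0

AffIndep-∷ : (p : Fin k → Subset n) → AffIndep p → (Y : Subset n) (u : Fin n → ℚ) (c : ℚ) →
             (∀ i → dot u (p i) ≡ c) → dot u Y ≢ c → AffIndep (Y VF.∷ p)
AffIndep-∷ {k} p p-indep Y u c p-on Y-off λs relation total = λs≡0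
  where
  open +-*-Solver
  s′ : ℚ
  s′ = sumFin k (λs ∘ suc)
  on-u : λs zero ℚ.* dot u Y ℚ.+ c ℚ.* s′ ≡ 0ℚ
  on-u = trans (cong (λs zero ℚ.* dot u Y ℚ.+_)
                 (trans (sumFin-*ˡ k c (λs ∘ suc))
                        (sumFin-cong k (λ i → trans (ℚP.*-comm c _) (cong (λs (suc i) ℚ.*_) (sym (p-on i)))))))
               (affine-relation-dot (Y VF.∷ p) λs relation u)
  head≡0 : λs zero ≡ 0ℚ
  head≡0 = *≡0⇒≡0 (λs zero) (dot u Y ℚ.- c) factored (Y-off ∘ x∙y⁻¹≈ε⇒x≈y (dot u Y) c)
    where
    factored : λs zero ℚ.* (dot u Y ℚ.- c) ≡ 0ℚ
    factored = begin
      λs zero ℚ.* (dot u Y ℚ.- c)                                     ≡⟨ solve 4 (λ a L c s → a :* (L :- c) := (a :* L :+ c :* s) :- c :* (a :+ s))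
                                                                           refl (λs zero) (dot u Y) c s′ ⟩
      (λs zero ℚ.* dot u Y ℚ.+ c ℚ.* s′) ℚ.- c ℚ.* (λs zero ℚ.+ s′)   ≡⟨ cong₂ (λ x y → x ℚ.- c ℚ.* y) on-u total ⟩
      0ℚ ℚ.- c ℚ.* 0ℚ                                                 ≡⟨ cong (λ x → 0ℚ ℚ.- x) (ℚP.*-zeroʳ c) ⟩
      0ℚ                                                              ∎
      where open ≡-Reasoning
  drop-head : ∀ {a} x z → a ≡ 0ℚ → a ℚ.* x ℚ.+ z ≡ 0ℚ → z ≡ 0ℚ
  drop-head x z refl e = trans (sym (solve 2 (λ x z → con 0ℚ :* x :+ z := z) refl x z)) e
  tail≡0 : ∀ i → λs (suc i) ≡ 0ℚ
  tail≡0 = p-indep (λs ∘ suc) (λ j → drop-head _ _ head≡0 (relation j))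
                              (drop-head 1ℚ _ head≡0 (trans (cong (ℚ._+ s′) (ℚP.*-identityʳ (λs zero))) total))
  λs≡0 : ∀ i → λs i ≡ 0ℚ
  λs≡0 zero    = head≡0
  λs≡0 (suc i) = tail≡0 i

fromℕ : ℕ → ℚ
fromℕ zero    = 0ℚ
fromℕ (suc m) = 1ℚ ℚ.+ fromℕ m

fromℕ-<-suc : ∀ m → fromℕ m ℚ.< fromℕ (suc m)
fromℕ-<-suc m = subst (ℚ._< fromℕ (suc m)) (ℚP.+-identityˡ (fromℕ m)) (ℚP.+-monoˡ-< (fromℕ m) (ℚP.positive⁻¹ 1ℚ))

fromℕ-< : {m m′ : ℕ} → m < m′ → fromℕ m ℚ.< fromℕ m′
fromℕ-< {m} {suc m′} (s≤s m≤m′) with ℕP.m≤n⇒m<n∨m≡n m≤m′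
... | inj₁ m<m′ = ℚP.<-trans (fromℕ-< m<m′) (fromℕ-<-suc m′)
... | inj₂ refl = fromℕ-<-suc m′

dot-iverson : (U : Fin n → Bool) (Y : Subset n) → dot (iversonℚ ∘ U) Y ≡ fromℕ ∣ U ∩ Y ∣
dot-iverson {zero}  U []      = refl
dot-iverson {suc n} U (y ∷ Y) =
  trans (cong (iversonℚ (U zero) ℚ.* iversonℚ y ℚ.+_) (dot-iverson (U ∘ suc) Y)) (head-term (U zero) y _)
  where
  head-term : ∀ a b m → iversonℚ a ℚ.* iversonℚ b ℚ.+ fromℕ m ≡ fromℕ (iverson (a ∧ b) + m)
  head-term true  true  m = cong (ℚ._+ fromℕ m) (ℚP.*-identityʳ 1ℚ)
  head-term true  false m = trans (cong (ℚ._+ fromℕ m) (ℚP.*-zeroʳ 1ℚ)) (ℚP.+-identityˡ _)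
  head-term false b     m = trans (cong (ℚ._+ fromℕ m) (ℚP.*-zeroˡ (iversonℚ b))) (ℚP.+-identityˡ _)

-- A facet is cut out by an upper level set

record LevelSetDescription (M : Matroid n) (w : Fin n → ℚ) : Set where
  field
    level         : Fin n → Bool
    upper         : UpperLevelSet w level
    meets⇒maximal : ∀ X → IsBasis M X → MaximallyMeets M level X → IsMaximiser M w X
    B₀            : Subset n
    B₀-basis      : IsBasis M B₀
    B₀-maximiser  : IsMaximiser M w B₀

module _ (M : Matroid n) (w : Fin n → ℚ) where

  face-basis⁻ : ∀ B → T (isBasisFace M w B) → IsBasis M B × IsMaximiser M w B
  face-basis⁻ B fB = let e = Equivalence.to BoolP.T-≡ fB in BoolP.∧-conicalˡ _ _ e , BoolP.∧-conicalʳ _ _ e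

  face-basis⁺ : ∀ B → IsBasis M B → IsMaximiser M w B → T (isBasisFace M w B)
  face-basis⁺ B bB mB = Equivalence.from BoolP.T-≡ (cong₂ _∧_ bB mB)

  non-maximiser⇒separated : ∀ B₀ → IsBasis M B₀ → IsMaximiser M w B₀ → ∀ X → IsBasis M X → maximises M w X ≡ false →
                            ∃[ t ] ∃[ Y ] IsBasis M Y × ∣ ≥-level w t ∩ Y ∣ < ∣ ≥-level w t ∩ B₀ ∣
  non-maximiser⇒separated B₀ bB₀ mB₀ X = walk _ X refl
    where
    walk : ∀ m X → ∣ not ∘ lookup B₀ ∩ X ∣ ≡ m → IsBasis M X → maximises M w X ≡ false →
           ∃[ t ] ∃[ Y ] IsBasis M Y × ∣ ≥-level w t ∩ Y ∣ < ∣ ≥-level w t ∩ B₀ ∣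
    walk zero X e bX mX = contradiction (trans (cong (maximises M w) X≡B₀) mB₀) (BoolP.not-¬ mX)
      where
      X≡B₀ : X ≡ B₀
      X≡B₀ = lookup-ext (bases-⊆⇒≡ M bX bB₀ (λ i Xi → BoolP.not-injective (∣∩∣≡0⇒disjoint _ X e i Xi)))
    walk (suc m) X e bX mX with ∣∩∣≡suc⇒∃ (not ∘ lookup B₀) X e
    ... | i , ¬B₀i , Xi with basis-exchange M bX bB₀ i Xi (BoolP.not-injective ¬B₀i)
    ...   | j , B₀j , Xj , bX′ with maximises M w (X ⟨ i ⇄ j ⟩) in mX′
    ...     | false = walk m (X ⟨ i ⇄ j ⟩)
                        (ℕP.suc-injective (trans (∣∩∣-⇄-↓ _ X i j Xi Xj ¬B₀i (cong not B₀j)) e)) bX′ mX′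
    ...     | true  = w j , X , bX , ℕP.<-≤-trans X<X′ (maximiser-maximally-meets M w (≥-level-upper w (w j)) B₀ bB₀ mB₀ _ bX′)
      where
      wi<wj : w i ℚ.< w j
      wi<wj = +-swap-< (trans (ℚP.+-comm (w j) _) (trans (sym (dot-⇄ w X i j Xi Xj)) (ℚP.+-comm _ (w i))))
                       (non-maximiser-< M w (X ⟨ i ⇄ j ⟩) X mX′ mX)
      X<X′ : ∣ ≥-level w (w j) ∩ X ∣ < ∣ ≥-level w (w j) ∩ X ⟨ i ⇄ j ⟩ ∣
      X<X′ = ℕP.≤-reflexive (sym (∣∩∣-⇄-↑ _ X i j Xi Xj
               (≥-level-false w (w j) i wi<wj) (≥-level-true w (w j) j ℚP.≤-refl)))


  vertex-off-face : (p : Fin k → Subset n) → (∀ i → T (isBasis M (p i))) → AffIndep p →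
                    ¬ (∃[ q ] (∀ i → T (isBasisFace M w (q i))) × AffIndep {n} {k} q) →
                    ∃[ i ] IsBasis M (p i) × maximises M w (p i) ≡ false
  vertex-off-face p p-bases p-indep face-too-small
    with FinP.all? (λ i → maximises M w (p i) Bool.≟ true)
  ... | yes all-on  = contradiction (p , (λ i → face-basis⁺ (p i) (p-basis i) (all-on i)) , p-indep) face-too-small
    where
    p-basis : ∀ i → IsBasis M (p i)
    p-basis i = Equivalence.to BoolP.T-≡ (p-bases i)
  ... | no  ¬all-on =
    let (i , off) = FinP.¬∀⟶∃¬ _ _ (λ i → maximises M w (p i) Bool.≟ true) ¬all-on
    in i , Equivalence.to BoolP.T-≡ (p-bases i) , BoolP.¬-not off

  meets-maximally⇒maximiser :
    ∀ {d} (f : Fin (suc d) → Subset n) → AffIndep f → (∀ k → T (isBasisFace M w (f k))) →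
    ¬ (∃[ q ] (∀ i → T (isBasis M (q i))) × AffIndep {n} {suc (suc (suc d))} q) →
    ∀ t Y → IsBasis M Y → ∣ ≥-level w t ∩ Y ∣ < ∣ ≥-level w t ∩ f zero ∣ →
    ∀ X → IsBasis M X → MaximallyMeets M (≥-level w t) X → IsMaximiser M w X
  meets-maximally⇒maximiser f f-indep f-face polytope-too-small t Y bY Y<B₀ X bX X-max with maximises M w X Bool.≟ true
  ... | yes mX  = mX
  ... | no  ¬mX = contradiction (Y VF.∷ X VF.∷ f , vertices , indep) polytope-too-small
    where
    -- w separates X from the face, and 1_U separates Y from X and the face.
    U : Fin n → Bool
    U = ≥-level w t
    B₀ : Subset n
    B₀ = f zero
    f-basis : ∀ k → IsBasis M (f k)
    f-basis k = proj₁ (face-basis⁻ (f k) (f-face k))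
    f-maximiser : ∀ k → IsMaximiser M w (f k)
    f-maximiser k = proj₂ (face-basis⁻ (f k) (f-face k))
    vertices : ∀ i → T (isBasis M ((Y VF.∷ X VF.∷ f) i))
    vertices zero          = Equivalence.from BoolP.T-≡ bY
    vertices (suc zero)    = Equivalence.from BoolP.T-≡ bX
    vertices (suc (suc k)) = Equivalence.from BoolP.T-≡ (f-basis k)
    meets-like-B₀ : ∀ Z → IsBasis M Z → MaximallyMeets M U Z → dot (iversonℚ ∘ U) Z ≡ fromℕ ∣ U ∩ B₀ ∣
    meets-like-B₀ Z bZ Z-max = trans (dot-iverson U Z)
      (cong fromℕ (ℕP.≤-antisym (maximiser-maximally-meets M w (≥-level-upper w t) B₀ (f-basis zero) (f-maximiser zero) Z bZ)
                                (Z-max B₀ (f-basis zero))))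
    X∷f-on-level : ∀ i → dot (iversonℚ ∘ U) ((X VF.∷ f) i) ≡ fromℕ ∣ U ∩ B₀ ∣
    X∷f-on-level zero    = meets-like-B₀ X bX X-max
    X∷f-on-level (suc k) = meets-like-B₀ (f k) (f-basis k)
                             (maximiser-maximally-meets M w (≥-level-upper w t) (f k) (f-basis k) (f-maximiser k))
    f-on-w : ∀ k → dot w (f k) ≡ dot w B₀
    f-on-w k = ℚP.≤-antisym (maximiser⇒≤ M w B₀ (f-maximiser zero) (f k) (f-basis k))
                            (maximiser⇒≤ M w (f k) (f-maximiser k) B₀ (f-basis zero))
    X-off-w : dot w X ≢ dot w B₀
    X-off-w = ℚP.<⇒≢ (non-maximiser-< M w B₀ X (f-maximiser zero) (BoolP.¬-not ¬mX))
    Y-off-level : dot (iversonℚ ∘ U) Y ≢ fromℕ ∣ U ∩ B₀ ∣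
    Y-off-level = ℚP.<⇒≢ (subst (ℚ._< fromℕ ∣ U ∩ B₀ ∣) (sym (dot-iverson U Y)) (fromℕ-< Y<B₀))
    indep : AffIndep (Y VF.∷ X VF.∷ f)
    indep = AffIndep-∷ (X VF.∷ f) (AffIndep-∷ f f-indep X w (dot w B₀) f-on-w X-off-w)
                       Y (iversonℚ ∘ U) (fromℕ ∣ U ∩ B₀ ∣) X∷f-on-level Y-off-level

  facet⇒level-set-description : IsFacet M w → LevelSetDescription M w
  facet⇒level-set-description (d , ((p , p-bases , p-indep) , polytope-too-small) , ((f , f-face , f-indep) , face-too-small))
    with vertex-off-face p p-bases p-indep face-too-small | face-basis⁻ (f zero) (f-face zero)
  ... | i , b-pi , off | bB₀ , mB₀ with non-maximiser⇒separated (f zero) bB₀ mB₀ (p i) b-pi off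
  ... | t , Y , bY , Y<B₀ = record
    { level         = ≥-level w t
    ; upper         = ≥-level-upper w t
    ; meets⇒maximal = meets-maximally⇒maximiser f f-indep f-face polytope-too-small t Y bY Y<B₀
    ; B₀            = f zero
    ; B₀-basis      = bB₀
    ; B₀-maximiser  = mB₀
    }

-- Splicing two bases along a level set

splice : (U : Fin n → Bool) → Subset n → Subset n → Subset n
splice U A C = tabulate (λ i → if U i then lookup C i else lookup A i)

lookup-splice : (U : Fin n → Bool) (A C : Subset n) (i : Fin n) →
                lookup (splice U A C) i ≡ (if U i then lookup C i else lookup A i)
lookup-splice U A C = VecP.lookup∘tabulate (λ i → if U i then lookup C i else lookup A i)

splice-idem : (U : Fin n → Bool) (A : Subset n) → splice U A A ≡ A
splice-idem U []      = refl
splice-idem U (a ∷ A) with U zero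
... | true  = cong (a ∷_) (splice-idem (U ∘ suc) A)
... | false = cong (a ∷_) (splice-idem (U ∘ suc) A)

_⊕_ : Subset n → Subset n → Subset n
_⊕_ = zipWith _xor_

⊕-cancelˡ : (D X : Subset n) → D ⊕ (D ⊕ X) ≡ X
⊕-cancelˡ []      []      = refl
⊕-cancelˡ (d ∷ D) (x ∷ X) =
  cong₂ _∷_ (trans (sym (BoolP.xor-assoc d d x)) (cong (_xor x) (BoolP.xor-same d))) (⊕-cancelˡ D X)

⊕-cancelʳ : (X D : Subset n) → (X ⊕ D) ⊕ D ≡ X
⊕-cancelʳ []      []      = refl
⊕-cancelʳ (x ∷ X) (d ∷ D) = cong₂ _∷_ (xor-cancelʳ x d) (⊕-cancelʳ X D)

does-⊕ : (D X Y : Subset n) → does ((D ⊕ X) ≟ˢ (D ⊕ Y)) ≡ does (X ≟ˢ Y)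
does-⊕ D X Y = BoolP.⇔→≡ {z = true} (mk⇔
  (λ e → dec-true (X ≟ˢ Y) (trans (sym (⊕-cancelˡ D X)) (trans (cong (D ⊕_) (dec-true⁻ e)) (⊕-cancelˡ D Y))))
  (λ e → dec-true ((D ⊕ X) ≟ˢ (D ⊕ Y)) (cong (D ⊕_) (dec-true⁻ e))))
  where
  dec-true⁻ : {Y₁ Y₂ : Subset n} → does (Y₁ ≟ˢ Y₂) ≡ true → Y₁ ≡ Y₂
  dec-true⁻ {Y₁ = Y₁} {Y₂} e with Y₁ ≟ˢ Y₂
  ... | yes Y₁≡Y₂ = Y₁≡Y₂

splice-⊕ : (U : Fin n → Bool) (D X₁ X₂ : Subset n) → splice U (splice U D ∅ ⊕ X₁) (splice U ∅ D ⊕ X₂) ≡ D ⊕ splice U X₁ X₂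
splice-⊕ U [] [] [] = refl
splice-⊕ U (d ∷ D) (x₁ ∷ X₁) (x₂ ∷ X₂) with U zero
... | true  = cong ((d xor x₂) ∷_) (splice-⊕ (U ∘ suc) D X₁ X₂)
... | false = cong ((d xor x₁) ∷_) (splice-⊕ (U ∘ suc) D X₁ X₂)

⊕-splice-outside : (U : Fin n → Bool) (B X₁ X₂ : Subset n) → splice U (B ⊕ splice U X₁ X₂) ∅ ⊕ X₁ ≡ splice U B X₁
⊕-splice-outside U [] [] [] = refl
⊕-splice-outside U (b ∷ B) (x₁ ∷ X₁) (x₂ ∷ X₂) with U zero
... | true  = cong (x₁ ∷_) (⊕-splice-outside (U ∘ suc) B X₁ X₂)
... | false = cong₂ _∷_ (xor-cancelʳ b x₁) (⊕-splice-outside (U ∘ suc) B X₁ X₂)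

⊕-splice-inside : (U : Fin n → Bool) (B X₁ X₂ : Subset n) → splice U ∅ (B ⊕ splice U X₁ X₂) ⊕ X₂ ≡ splice U X₂ B
⊕-splice-inside U [] [] [] = refl
⊕-splice-inside U (b ∷ B) (x₁ ∷ X₁) (x₂ ∷ X₂) with U zero
... | true  = cong₂ _∷_ (xor-cancelʳ b x₂) (⊕-splice-inside (U ∘ suc) B X₁ X₂)
... | false = cong (x₂ ∷_) (⊕-splice-inside (U ∘ suc) B X₁ X₂)

splice-⊕-outside : (U : Fin n → Bool) (B X₁ X₂ : Subset n) →
                   X₁ ≡ splice U (splice U X₁ X₂) (splice U (B ⊕ splice U X₁ X₂) ∅ ⊕ X₁)
splice-⊕-outside U [] [] [] = refl
splice-⊕-outside U (b ∷ B) (x₁ ∷ X₁) (x₂ ∷ X₂) with U zero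
... | true  = cong (x₁ ∷_) (splice-⊕-outside (U ∘ suc) B X₁ X₂)
... | false = cong (x₁ ∷_) (splice-⊕-outside (U ∘ suc) B X₁ X₂)

splice-⊕-inside : (U : Fin n → Bool) (B X₁ X₂ : Subset n) →
                  X₂ ≡ splice U (splice U ∅ (B ⊕ splice U X₁ X₂) ⊕ X₂) (splice U X₁ X₂)
splice-⊕-inside U [] [] [] = refl
splice-⊕-inside U (b ∷ B) (x₁ ∷ X₁) (x₂ ∷ X₂) with U zero
... | true  = cong (x₂ ∷_) (splice-⊕-inside (U ∘ suc) B X₁ X₂)
... | false = cong (x₂ ∷_) (splice-⊕-inside (U ∘ suc) B X₁ X₂)

module _ (M : Matroid n) (U : Fin n → Bool) where

  maximal-meets-∁-equally : ∀ {X Y} → IsBasis M X → IsBasis M Y → ∣ U ∩ X ∣ ≡ ∣ U ∩ Y ∣ → ∣ not ∘ U ∩ X ∣ ≡ ∣ not ∘ U ∩ Y ∣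
  maximal-meets-∁-equally {X} {Y} bX bY eq = ℕP.+-cancelˡ-≡ ∣ U ∩ X ∣ _ _ (begin
    ∣ U ∩ X ∣ + ∣ not ∘ U ∩ X ∣ ≡⟨ ∣∩∣+∣∁∩∣≡size U X ⟩
    size X                      ≡⟨ bases-equicardinal M bX bY ⟩
    size Y                      ≡⟨ ∣∩∣+∣∁∩∣≡size U Y ⟨
    ∣ U ∩ Y ∣ + ∣ not ∘ U ∩ Y ∣ ≡⟨ cong (_+ ∣ not ∘ U ∩ Y ∣) eq ⟨
    ∣ U ∩ X ∣ + ∣ not ∘ U ∩ Y ∣ ∎)
    where open ≡-Reasoning

  splice-maximal : ∀ A C → IsBasis M A → MaximallyMeets M U A → IsBasis M C → MaximallyMeets M U C →
                   IsBasis M (splice U A C) × MaximallyMeets M U (splice U A C)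
  splice-maximal A C bA A-max bC C-max = walk _ C refl bC C-max (λ _ _ → refl)
    where
    -- Starting from C, exchange elements outside U ∪ A for elements of A; these never lie in U,
    -- since that would make Y meet U more than the maximum.
    Q : Fin n → Bool
    Q i = not (U i) ∧ not (lookup A i)
    walk : ∀ m Y → ∣ Q ∩ Y ∣ ≡ m → IsBasis M Y → MaximallyMeets M U Y → (∀ i → U i ≡ true → lookup Y i ≡ lookup C i) →
           IsBasis M (splice U A C) × MaximallyMeets M U (splice U A C)
    walk zero Y e bY Y-max Y≗C = subst (λ Z → IsBasis M Z × MaximallyMeets M U Z) (lookup-ext Y≗splice) (bY , Y-max)
      where
      outside-Y⊆A : (λ i → not (U i) ∧ lookup Y i) ⊆ᵇ (λ i → not (U i) ∧ lookup A i)
      outside-Y⊆A i ¬Ui∧Yi =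
        let ¬Ui = BoolP.∧-conicalˡ _ _ ¬Ui∧Yi
            Qi = ∣∩∣≡0⇒disjoint Q Y e i (BoolP.∧-conicalʳ _ _ ¬Ui∧Yi)
        in cong₂ _∧_ ¬Ui (BoolP.not-injective (trans (sym (cong (_∧ not (lookup A i)) ¬Ui)) Qi))
      outside-Y≗A : ∀ i → not (U i) ∧ lookup Y i ≡ not (U i) ∧ lookup A i
      outside-Y≗A = count-⊆ᵇ-≡ outside-Y⊆A
        (maximal-meets-∁-equally bY bA (ℕP.≤-antisym (A-max Y bY) (Y-max A bA)))
      Y≗splice : ∀ i → lookup Y i ≡ lookup (splice U A C) i
      Y≗splice i rewrite lookup-splice U A C i with U i in Ui
      ... | true  = Y≗C i Ui
      ... | false = trans (sym (cong (λ u → not u ∧ lookup Y i) Ui))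
                          (trans (outside-Y≗A i) (cong (λ u → not u ∧ lookup A i) Ui))
    walk (suc m) Y e bY Y-max Y≗C with ∣∩∣≡suc⇒∃ Q Y e
    ... | i , Qi , Yi with basis-exchange M bY bA i Yi (BoolP.not-injective (BoolP.∧-conicalʳ _ _ Qi))
    ...   | j , Aj , Yj , bY′ with U j in Uj
    ...     | true  = contradiction (Y-max (Y ⟨ i ⇄ j ⟩) bY′)
                        (ℕP.<⇒≱ (ℕP.≤-reflexive (sym (∣∩∣-⇄-↑ U Y i j Yi Yj Ui Uj))))
      where
      Ui : U i ≡ false
      Ui = BoolP.not-injective (BoolP.∧-conicalˡ _ _ Qi)
    ...     | false = walk m (Y ⟨ i ⇄ j ⟩) (ℕP.suc-injective (trans (∣∩∣-⇄-↓ Q Y i j Yi Yj Qi Qj) e)) bY′ Y′-max Y′≗C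
      where
      Ui : U i ≡ false
      Ui = BoolP.not-injective (BoolP.∧-conicalˡ _ _ Qi)
      Qj : Q j ≡ false
      Qj = cong₂ (λ u a → not u ∧ not a) Uj Aj
      Y′-max : MaximallyMeets M U (Y ⟨ i ⇄ j ⟩)
      Y′-max Z bZ = subst (∣ U ∩ Z ∣ ≤_) (sym (∣∩∣-⇄-≡ U Y i j Yi Yj (trans Ui (sym Uj)))) (Y-max Z bZ)
      Y′≗C : ∀ k → U k ≡ true → lookup (Y ⟨ i ⇄ j ⟩) k ≡ lookup C k
      Y′≗C k Uk = trans (lookup-⇄-other Y (separated-by U Uk Ui) (separated-by U Uk Uj)) (Y≗C k Uk)

when : Bool → ℚ → ℚ
when b v = if b then v else 0ℚ

when-when : ∀ a b c (y : ℚ) → when a (when b (when c y)) ≡ iversonℚ (a ∧ (b ∧ c)) ℚ.* y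
when-when true  true  true  y = sym (ℚP.*-identityˡ y)
when-when true  true  false y = sym (ℚP.*-zeroˡ y)
when-when true  false c     y = sym (ℚP.*-zeroˡ y)
when-when false b     c     y = sym (ℚP.*-zeroˡ y)

module _ {A : Set} where

  sumOver : List A → (A → ℚ) → ℚ
  sumOver []       f = 0ℚ
  sumOver (x ∷ xs) f = f x ℚ.+ sumOver xs f

  sumOver-cong : ∀ xs {f g : A → ℚ} → (∀ x → f x ≡ g x) → sumOver xs f ≡ sumOver xs g
  sumOver-cong []       f≗g = refl
  sumOver-cong (x ∷ xs) f≗g = cong₂ ℚ._+_ (f≗g x) (sumOver-cong xs f≗g)

  sumOver-zero : ∀ xs {f : A → ℚ} → (∀ x → f x ≡ 0ℚ) → sumOver xs f ≡ 0ℚ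
  sumOver-zero []       f≗0 = refl
  sumOver-zero (x ∷ xs) f≗0 = trans (cong₂ ℚ._+_ (f≗0 x) (sumOver-zero xs f≗0)) (ℚP.+-identityʳ 0ℚ)

  sumOver-++ : ∀ xs ys (f : A → ℚ) → sumOver (xs ++ ys) f ≡ sumOver xs f ℚ.+ sumOver ys f
  sumOver-++ []       ys f = sym (ℚP.+-identityˡ _)
  sumOver-++ (x ∷ xs) ys f = trans (cong (f x ℚ.+_) (sumOver-++ xs ys f)) (sym (ℚP.+-assoc (f x) _ _))

  sumOver-+ : ∀ xs (f g : A → ℚ) → sumOver xs (λ x → f x ℚ.+ g x) ≡ sumOver xs f ℚ.+ sumOver xs g
  sumOver-+ []       f g = sym (ℚP.+-identityʳ 0ℚ)
  sumOver-+ (x ∷ xs) f g =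
    trans (cong (f x ℚ.+ g x ℚ.+_) (sumOver-+ xs f g))
          (solve 4 (λ a b c d → (a :+ b) :+ (c :+ d) := (a :+ c) :+ (b :+ d)) refl (f x) (g x) _ _)
    where open +-*-Solver

  sumOver-*ʳ : ∀ xs (f : A → ℚ) (c : ℚ) → sumOver xs f ℚ.* c ≡ sumOver xs (λ x → f x ℚ.* c)
  sumOver-*ʳ []       f c = ℚP.*-zeroˡ c
  sumOver-*ʳ (x ∷ xs) f c = trans (ℚP.*-distribʳ-+ c (f x) _) (cong (f x ℚ.* c ℚ.+_) (sumOver-*ʳ xs f c))

  sumOver-when : ∀ xs (b : Bool) (f : A → ℚ) → when b (sumOver xs f) ≡ sumOver xs (λ x → when b (f x))
  sumOver-when xs true  f = refl
  sumOver-when xs false f = sym (sumOver-zero xs λ _ → refl)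

  sumOver-filter : {P : A → Set} (P? : (x : A) → Dec (P x)) (xs : List A) (f : A → ℚ) →
                   sumOver (filter P? xs) f ≡ sumOver xs (λ x → when (does (P? x)) (f x))
  sumOver-filter P? []       f = refl
  sumOver-filter P? (x ∷ xs) f with does (P? x)
  ... | true  = cong (f x ℚ.+_) (sumOver-filter P? xs f)
  ... | false = trans (sumOver-filter P? xs f) (sym (ℚP.+-identityˡ _))

  sumOver-nonneg : ∀ xs {f : A → ℚ} → (∀ x → 0ℚ ℚ.≤ f x) → 0ℚ ℚ.≤ sumOver xs f
  sumOver-nonneg []       f≥0 = ℚP.≤-refl
  sumOver-nonneg (x ∷ xs) {f} f≥0 = subst (ℚ._≤ f x ℚ.+ sumOver xs f) (ℚP.+-identityʳ 0ℚ) (ℚP.+-mono-≤ (f≥0 x) (sumOver-nonneg xs f≥0))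

  sumOver-≥ : ∀ {xs} {f : A → ℚ} → (∀ x → 0ℚ ℚ.≤ f x) → ∀ {y} → y ∈ xs → f y ℚ.≤ sumOver xs f
  sumOver-≥ {y ∷ xs} {f} f≥0 (here refl) =
    subst (ℚ._≤ f y ℚ.+ sumOver xs f) (ℚP.+-identityʳ (f y)) (ℚP.+-monoʳ-≤ (f y) (sumOver-nonneg xs f≥0))
  sumOver-≥ {x ∷ xs} {f} f≥0 {y} (there y∈xs) =
    subst (ℚ._≤ f x ℚ.+ sumOver xs f) (ℚP.+-identityˡ (f y)) (ℚP.+-mono-≤ (f≥0 x) (sumOver-≥ f≥0 y∈xs))

module _ {A B : Set} where

  sumOver-map : (g : A → B) (xs : List A) (f : B → ℚ) → sumOver (map g xs) f ≡ sumOver xs (f ∘ g)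
  sumOver-map g []       f = refl
  sumOver-map g (x ∷ xs) f = cong (f (g x) ℚ.+_) (sumOver-map g xs f)

  sumOver-concatMap : (g : A → List B) (xs : List A) (f : B → ℚ) →
                      sumOver (concatMap g xs) f ≡ sumOver xs (λ x → sumOver (g x) f)
  sumOver-concatMap g []       f = refl
  sumOver-concatMap g (x ∷ xs) f =
    trans (sumOver-++ (g x) (concatMap g xs) f) (cong (sumOver (g x) f ℚ.+_) (sumOver-concatMap g xs f))

  sumOver-comm : (xs : List A) (ys : List B) (f : A → B → ℚ) →
                 sumOver xs (λ x → sumOver ys (f x)) ≡ sumOver ys (λ y → sumOver xs (λ x → f x y))
  sumOver-comm []       ys f = sym (sumOver-zero ys λ _ → refl)
  sumOver-comm (x ∷ xs) ys f =
    trans (cong (sumOver ys (f x) ℚ.+_) (sumOver-comm xs ys f)) (sym (sumOver-+ ys (f x) (λ y → sumOver xs (λ x′ → f x′ y))))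

sumSubsets : ∀ n → (Subset n → ℚ) → ℚ
sumSubsets n = sumOver (subsets n)

sumSubsets-split : ∀ n (f : Subset (suc n) → ℚ) →
                   sumSubsets (suc n) f ≡ sumSubsets n (λ X → f (true ∷ X)) ℚ.+ sumSubsets n (λ X → f (false ∷ X))
sumSubsets-split n f =
  trans (sumOver-++ (map (true ∷_) (subsets n)) _ f)
        (cong₂ ℚ._+_ (sumOver-map (true ∷_) (subsets n) f) (sumOver-map (false ∷_) (subsets n) f))

sumSubsets-⊕ : ∀ n (m : Subset n) (f : Subset n → ℚ) → sumSubsets n (λ X → f (m ⊕ X)) ≡ sumSubsets n f
sumSubsets-⊕ zero    []          f = refl
sumSubsets-⊕ (suc n) (true ∷ m)  f = begin
  sumSubsets (suc n) (λ X → f ((true ∷ m) ⊕ X))                             ≡⟨ sumSubsets-split n _ ⟩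
  sumSubsets n (λ X → f (false ∷ m ⊕ X)) ℚ.+ sumSubsets n (λ X → f (true ∷ m ⊕ X)) ≡⟨ cong₂ ℚ._+_ (sumSubsets-⊕ n m _) (sumSubsets-⊕ n m _) ⟩
  sumSubsets n (λ X → f (false ∷ X)) ℚ.+ sumSubsets n (λ X → f (true ∷ X))   ≡⟨ ℚP.+-comm (sumSubsets n (λ X → f (false ∷ X))) _ ⟩
  sumSubsets n (λ X → f (true ∷ X)) ℚ.+ sumSubsets n (λ X → f (false ∷ X))   ≡⟨ sumSubsets-split n f ⟨
  sumSubsets (suc n) f                                                      ∎
  where open ≡-Reasoning
sumSubsets-⊕ (suc n) (false ∷ m) f =
  trans (sumSubsets-split n _)
        (trans (cong₂ ℚ._+_ (sumSubsets-⊕ n m _) (sumSubsets-⊕ n m _)) (sym (sumSubsets-split n f)))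

sumSubsets-δ : ∀ n (Y : Subset n) (g : Subset n → ℚ) → sumSubsets n (λ X → when (does (Y ≟ˢ X)) (g X)) ≡ g Y
sumSubsets-δ zero    []          g = ℚP.+-identityʳ (g [])
sumSubsets-δ (suc n) (true ∷ Y)  g =
  trans (sumSubsets-split n _)
        (trans (cong₂ ℚ._+_ (sumSubsets-δ n Y (g ∘ (true ∷_))) (sumOver-zero (subsets n) λ _ → refl)) (ℚP.+-identityʳ _))
sumSubsets-δ (suc n) (false ∷ Y) g =
  trans (sumSubsets-split n _)
        (trans (cong₂ ℚ._+_ (sumOver-zero (subsets n) λ _ → refl) (sumSubsets-δ n Y (g ∘ (false ∷_)))) (ℚP.+-identityˡ _))

module _ {A : Set} (f : A → ℕ) (x : A) (xs : List A) where

  maxOn minOn : ℕ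
  maxOn = foldr _⊔_ (f x) (map f xs)
  minOn = foldr _⊓_ (f x) (map f xs)

  ≤-maxOn : ∀ {y} → y ∈ x ∷ xs → f y ≤ maxOn
  ≤-maxOn (here refl) = ListP.foldr-preservesʳ {P = f x ≤_} (λ a fx≤ → ℕP.≤-trans fx≤ (ℕP.m≤n⊔m a _)) ℕP.≤-refl (map f xs)
  ≤-maxOn (there y∈xs) =
    All.lookup (ListP.foldr-forcesᵇ {P = _≤ maxOn} (λ a b ≤ → ℕP.m⊔n≤o⇒m≤o a b ≤ , ℕP.m⊔n≤o⇒n≤o a b ≤) (f x) (map f xs) ℕP.≤-refl)
               (∈-map⁺ f y∈xs)

  minOn-≤ : ∀ {y} → y ∈ x ∷ xs → minOn ≤ f y
  minOn-≤ (here refl) = ListP.foldr-preservesʳ {P = _≤ f x} (λ a ≤fx → ℕP.≤-trans (ℕP.m⊓n≤n a _) ≤fx) ℕP.≤-refl (map f xs)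
  minOn-≤ (there y∈xs) =
    All.lookup (ListP.foldr-forcesᵇ {P = minOn ≤_} (λ a b ≤ → ℕP.≤-trans ≤ (ℕP.m⊓n≤m a b) , ℕP.≤-trans ≤ (ℕP.m⊓n≤n a b))
                              (f x) (map f xs) ℕP.≤-refl)
               (∈-map⁺ f y∈xs)

  attained : ∀ {_•_ : ℕ → ℕ → ℕ} → (∀ a b → a • b ≡ a ⊎ a • b ≡ b) → ∃[ y ] y ∈ x ∷ xs × f y ≡ foldr _•_ (f x) (map f xs)
  attained sel with foldr-selective sel (f x) (map f xs)
  ... | inj₁ ≡fx = x , here refl , sym ≡fx
  ... | inj₂ ∈fxs = let (y , y∈xs , ≡fy) = ∈-map⁻ f ∈fxs in y , there y∈xs , sym ≡fy

  ≡maxOn⇔ : ∀ {y} → y ∈ x ∷ xs → (f y ≡ maxOn ⇔ (∀ z → z ∈ x ∷ xs → f z ≤ f y))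
  ≡maxOn⇔ {y} y∈ = mk⇔ (λ fy≡max z z∈ → subst (f z ≤_) (sym fy≡max) (≤-maxOn z∈))
    (λ y-max → let (z , z∈ , fz≡max) = attained ℕP.⊔-sel in ℕP.≤-antisym (≤-maxOn y∈) (subst (_≤ f y) fz≡max (y-max z z∈)))

  ≡minOn⇔ : ∀ {y} → y ∈ x ∷ xs → (f y ≡ minOn ⇔ (∀ z → z ∈ x ∷ xs → f y ≤ f z))
  ≡minOn⇔ {y} y∈ = mk⇔ (λ fy≡min z z∈ → subst (_≤ f z) (sym fy≡min) (minOn-≤ z∈))
    (λ y-min → let (z , z∈ , fz≡min) = attained ℕP.⊓-sel in ℕP.≤-antisym (subst (f y ≤_) fz≡min (y-min z z∈)) (minOn-≤ y∈))

contribution : Mono n → Mono n → ℚ → ℚ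
contribution β α c = when (does (VecP.≡-dec ℕ._≟_ β α)) c

contribution-*ˡ : (β α : Mono n) (a v : ℚ) → a ℚ.* contribution β α v ≡ contribution β α (a ℚ.* v)
contribution-*ˡ β α a v with does (VecP.≡-dec ℕ._≟_ β α)
... | true  = refl
... | false = ℚP.*-zeroʳ a

coeff-sumOver : (p : Poly n) (α : Mono n) → coeff p α ≡ sumOver p (λ t → contribution (proj₂ t) α (proj₁ t))
coeff-sumOver []            α = refl
coeff-sumOver ((c , β) ∷ p) α with VecP.≡-dec ℕ._≟_ β α
... | yes _ = cong (c ℚ.+_) (coeff-sumOver p α)
... | no  _ = trans (coeff-sumOver p α) (sym (ℚP.+-identityˡ _))

coeff-scale-·P : (c : ℚ) (p q : Poly n) (α : Mono n) →
                 coeff (scale c (p ·P q)) α ≡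
                 sumOver p (λ t → sumOver q (λ s → contribution (zipWith _+_ (proj₂ t) (proj₂ s)) α (c ℚ.* (proj₁ t ℚ.* proj₁ s))))
coeff-scale-·P c p q α =
  trans (coeff-sumOver (scale c (p ·P q)) α)
 (trans (sumOver-map (map₁ (c ℚ.*_)) (p ·P q) _)
 (trans (sumOver-concatMap (λ t → map (product-term t) q) p _)
        (sumOver-cong p (λ t → sumOver-map (product-term t) q _))))
  where
  product-term : ℚ × Mono n → ℚ × Mono n → ℚ × Mono n
  product-term t s = proj₁ t ℚ.* proj₁ s , zipWith _+_ (proj₂ t) (proj₂ s)

top-≡ : (p : Poly n) {d : ℕ} {ds : List ℕ} → degrees p ≡ d ∷ ds → top p ≡ homog (foldr _⊔_ d ds) p
top-≡ p e with degrees p | e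
... | _ | refl = refl

low-≡ : (p : Poly n) {d : ℕ} {ds : List ℕ} → degrees p ≡ d ∷ ds → low p ≡ homog (foldr _⊓_ d ds) p
low-≡ p e with degrees p | e
... | _ | refl = refl

module _ {A : Set} (m : A → Mono n) where

  monomials : List A → Poly n
  monomials = map (λ X → 1ℚ , m X)

  coeff-monomials : ∀ L α → coeff (monomials L) α ≡ sumOver L (λ X → contribution (m X) α 1ℚ)
  coeff-monomials L α = trans (coeff-sumOver (monomials L) α) (sumOver-map _ L _)

  degrees-monomials : ∀ L → degrees (monomials L) ≡ map (deg ∘ m) L
  degrees-monomials L =
    trans (cong (map (λ t → deg (proj₂ t))) (ListP.filter-all (λ t → ¬? (coeff (monomials L) (proj₂ t) ℚ.≟ 0ℚ))
                                                                 (AllP.map⁺ (All.tabulate nonzero))))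
          (sym (ListP.map-∘ L))
    where
    contribution≥0 : ∀ X α → 0ℚ ℚ.≤ contribution (m X) α 1ℚ
    contribution≥0 X α with does (VecP.≡-dec ℕ._≟_ (m X) α)
    ... | true  = ℚP.<⇒≤ (ℚP.positive⁻¹ 1ℚ)
    ... | false = ℚP.≤-refl
    nonzero : ∀ {X} → X ∈ L → coeff (monomials L) (m X) ≢ 0ℚ
    nonzero {X} X∈L coeff≡0 = ℚP.<-irrefl refl (ℚP.<-≤-trans (ℚP.positive⁻¹ 1ℚ) (begin
      1ℚ                                      ≡⟨ cong (λ b → when b 1ℚ) (dec-true (VecP.≡-dec ℕ._≟_ (m X) (m X)) refl) ⟨
      contribution (m X) (m X) 1ℚ             ≤⟨ sumOver-≥ (λ Y → contribution≥0 Y (m X)) X∈L ⟩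
      sumOver L (λ Y → contribution (m Y) (m X) 1ℚ) ≡⟨ coeff-monomials L (m X) ⟨
      coeff (monomials L) (m X)               ≡⟨ coeff≡0 ⟩
      0ℚ                                      ∎))
      where open ℚP.≤-Reasoning

  sumOver-homog-monomials : ∀ K L (g : ℚ × Mono n → ℚ) →
                            sumOver (homog K (monomials L)) g ≡ sumOver L (λ X → when (does (deg (m X) ℕ.≟ K)) (g (1ℚ , m X)))
  sumOver-homog-monomials K L g =
    trans (sumOver-filter (λ t → deg (proj₂ t) ℕ.≟ K) (monomials L) g) (sumOver-map _ L _)

  module _ (f : A → ℕ) (deg≡f : ∀ X → deg (m X) ≡ f X) where

    degrees-monomials-∷ : ∀ X Xs → degrees (monomials (X ∷ Xs)) ≡ f X ∷ map f Xs
    degrees-monomials-∷ X Xs = trans (degrees-monomials (X ∷ Xs)) (ListP.map-cong deg≡f (X ∷ Xs))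

    top-monomials : ∀ {L x} → x ∈ L →
                    ∃[ K ] top (monomials L) ≡ homog K (monomials L) × (∀ {y} → y ∈ L → (f y ≡ K ⇔ (∀ z → z ∈ L → f z ≤ f y)))
    top-monomials {X ∷ Xs} _ = maxOn f X Xs , top-≡ (monomials (X ∷ Xs)) (degrees-monomials-∷ X Xs) , ≡maxOn⇔ f X Xs

    low-monomials : ∀ {L x} → x ∈ L →
                    ∃[ K ] low (monomials L) ≡ homog K (monomials L) × (∀ {y} → y ∈ L → (f y ≡ K ⇔ (∀ z → z ∈ L → f y ≤ f z)))
    low-monomials {X ∷ Xs} _ = minOn f X Xs , low-≡ (monomials (X ∷ Xs)) (degrees-monomials-∷ X Xs) , ≡minOn⇔ f X Xs

χ : Subset n → Mono n
χ = Vec.map (λ b → if b then 1 else 0)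

mask : Subset n → Mono n → Mono n
mask T α = tabulate (λ i → if lookup T i then 0 else lookup α i)

subst1-monomials : {A : Set} (T : Subset n) (m : A → Mono n) (L : List A) → subst1 T (monomials m L) ≡ monomials (mask T ∘ m) L
subst1-monomials T m L = sym (ListP.map-∘ L)

deg-mask-χ : (T X : Subset n) → deg (mask T (χ X)) ≡ count (λ i → not (lookup T i) ∧ lookup X i)
deg-mask-χ []      []      = refl
deg-mask-χ (t ∷ T) (x ∷ X) = cong₂ _+_ (head-term t x) (deg-mask-χ T X)
  where
  head-term : ∀ t x → (if t then 0 else (if x then 1 else 0)) ≡ iverson (not t ∧ x)
  head-term true  x     = refl
  head-term false true  = refl
  head-term false false = refl

module _ (U : Fin n → Bool) where

  outsideU : Subset n
  outsideU = tabulate (not ∘ U)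

  lookup-outsideU : ∀ i → lookup outsideU i ≡ not (U i)
  lookup-outsideU = VecP.lookup∘tabulate (not ∘ U)

  lookup-insideU : ∀ i → lookup (∁ outsideU) i ≡ U i
  lookup-insideU i = trans (VecP.lookup-map i not outsideU) (trans (cong not (lookup-outsideU i)) (BoolP.not-involutive (U i)))

  deg-mask-outsideU : ∀ X → deg (mask outsideU (χ X)) ≡ ∣ U ∩ X ∣
  deg-mask-outsideU X =
    trans (deg-mask-χ outsideU X)
          (count-cong (λ i → cong (_∧ lookup X i) (trans (cong not (lookup-outsideU i)) (BoolP.not-involutive (U i)))))

  deg-mask-insideU : ∀ X → deg (mask (∁ outsideU) (χ X)) ≡ ∣ not ∘ U ∩ X ∣
  deg-mask-insideU X = trans (deg-mask-χ (∁ outsideU) X) (count-cong (λ i → cong (λ b → not b ∧ lookup X i) (lookup-insideU i)))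

  mask-+-mask : ∀ X₁ X₂ → zipWith _+_ (mask (∁ outsideU) (χ X₁)) (mask outsideU (χ X₂)) ≡ χ (splice U X₁ X₂)
  mask-+-mask X₁ X₂ = lookup-ext pointwise
    where
    lookup-mask : ∀ T α i → lookup (mask T α) i ≡ (if lookup T i then 0 else lookup α i)
    lookup-mask T α = VecP.lookup∘tabulate (λ i → if lookup T i then 0 else lookup α i)
    lookup-χ : ∀ X i → lookup (χ X) i ≡ (if lookup X i then 1 else 0)
    lookup-χ X i = VecP.lookup-map i (λ b → if b then 1 else 0) X
    pointwise : ∀ i → lookup (zipWith _+_ (mask (∁ outsideU) (χ X₁)) (mask outsideU (χ X₂))) i ≡ lookup (χ (splice U X₁ X₂)) i
    pointwise i rewrite VecP.lookup-zipWith _+_ i (mask (∁ outsideU) (χ X₁)) (mask outsideU (χ X₂))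
                      | lookup-mask (∁ outsideU) (χ X₁) i | lookup-mask outsideU (χ X₂) i
                      | lookup-insideU i | lookup-outsideU i
                      | lookup-χ X₁ i | lookup-χ X₂ i | lookup-χ (splice U X₁ X₂) i | lookup-splice U X₁ X₂ i
                      with U i
    ... | true  = refl
    ... | false = ℕP.+-identityʳ _

-- Bases meeting a level set maximally

module LevelMaximal (M : Matroid n) (U : Fin n → Bool) (F : Subset n → Bool)
                    (F⇔ : ∀ X → (F X ≡ true) ⇔ (IsBasis M X × MaximallyMeets M U X))
                    (B₀ : Subset n) (F-B₀ : F B₀ ≡ true) where

  bases : List (Subset n)
  bases = filter (λ B → T? (isBasis M B)) (subsets n)

  ∈-bases⁺ : ∀ {X} → IsBasis M X → X ∈ bases
  ∈-bases⁺ {X} bX = ∈-filter⁺ (λ B → T? (isBasis M B)) (∈-subsets X) (Equivalence.from BoolP.T-≡ bX)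

  ∈-bases⁻ : ∀ {X} → X ∈ bases → IsBasis M X
  ∈-bases⁻ X∈ = Equivalence.to BoolP.T-≡ (proj₂ (∈-filter⁻ (λ B → T? (isBasis M B)) {xs = subsets n} X∈))

  F⇒basis : ∀ {X} → F X ≡ true → IsBasis M X
  F⇒basis {X} FX = proj₁ (Equivalence.to (F⇔ X) FX)

  F-splice : ∀ {A C} → F A ≡ true → F C ≡ true → F (splice U A C) ≡ true
  F-splice {A} {C} FA FC =
    let (bA , A-max) = Equivalence.to (F⇔ A) FA
        (bC , C-max) = Equivalence.to (F⇔ C) FC
    in Equivalence.from (F⇔ (splice U A C)) (splice-maximal M U A C bA A-max bC C-max)

  when-basis : ∀ X {P : Set} (P? : Dec P) (v : ℚ) → (IsBasis M X → P ⇔ MaximallyMeets M U X) →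
               when (isBasis M X) (when (does P?) v) ≡ when (F X) v
  when-basis X P? v P⇔max with isBasis M X in bX
  ... | true  = cong (λ b → when b v) (does-≡ P? (F X) (mk⇔
                  (λ p → Equivalence.from (F⇔ X) (bX , Equivalence.to (P⇔max refl) p))
                  (λ FX → Equivalence.from (P⇔max refl) (proj₂ (Equivalence.to (F⇔ X) FX)))))
  ... | false with F X in FX
  ...   | false = refl
  ...   | true  = contradiction (trans (sym (F⇒basis FX)) bX) λ ()

  among-bases⇔ : ∀ X → (∀ Z → Z ∈ bases → ∣ U ∩ Z ∣ ≤ ∣ U ∩ X ∣) ⇔ MaximallyMeets M U X
  among-bases⇔ X = mk⇔ (λ X-max Z bZ → X-max Z (∈-bases⁺ bZ)) (λ X-max Z Z∈ → X-max Z (∈-bases⁻ Z∈))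

  transport-≡K : {a b K : ℕ} → a ≡ b → (a ≡ K) ⇔ (b ≡ K)
  transport-≡K a≡b = mk⇔ (trans (sym a≡b)) (trans a≡b)

  top-part : ∃[ K ] top (subst1 (outsideU U) (h M)) ≡ homog K (monomials (mask (outsideU U) ∘ χ) bases)
                    × (∀ X → IsBasis M X → (deg (mask (outsideU U) (χ X)) ≡ K) ⇔ MaximallyMeets M U X)
  top-part with top-monomials (mask (outsideU U) ∘ χ) (λ X → ∣ U ∩ X ∣) (deg-mask-outsideU U) (∈-bases⁺ (F⇒basis F-B₀))
  ... | K , top≡ , ≡K⇔ =
    K , trans (cong top (subst1-monomials (outsideU U) χ bases)) top≡ ,
    λ X bX → among-bases⇔ X ⇔-∘ (≡K⇔ (∈-bases⁺ bX) ⇔-∘ transport-≡K (deg-mask-outsideU U X))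

  low-part : ∃[ K ] low (subst1 (∁ (outsideU U)) (h M)) ≡ homog K (monomials (mask (∁ (outsideU U)) ∘ χ) bases)
                    × (∀ X → IsBasis M X → (deg (mask (∁ (outsideU U)) (χ X)) ≡ K) ⇔ MaximallyMeets M U X)
  low-part with low-monomials (mask (∁ (outsideU U)) ∘ χ) (λ X → ∣ not ∘ U ∩ X ∣) (deg-mask-insideU U) (∈-bases⁺ (F⇒basis F-B₀))
  ... | K , low≡ , ≡K⇔ =
    K , trans (cong low (subst1-monomials (∁ (outsideU U)) χ bases)) low≡ ,
    λ X bX → among-bases⇔ X ⇔-∘ (complement bX ⇔-∘ (≡K⇔ (∈-bases⁺ bX) ⇔-∘ transport-≡K (deg-mask-insideU U X)))
    where
    complement : ∀ {X} → IsBasis M X →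
                 (∀ Z → Z ∈ bases → ∣ not ∘ U ∩ X ∣ ≤ ∣ not ∘ U ∩ Z ∣) ⇔ (∀ Z → Z ∈ bases → ∣ U ∩ Z ∣ ≤ ∣ U ∩ X ∣)
    complement {X} bX = mk⇔ (λ X-min Z Z∈ → Equivalence.to (sizes Z∈) (X-min Z Z∈))
                            (λ X-max Z Z∈ → Equivalence.from (sizes Z∈) (X-max Z Z∈))
      where
      sizes : ∀ {Z} → Z ∈ bases → (∣ not ∘ U ∩ X ∣ ≤ ∣ not ∘ U ∩ Z ∣) ⇔ (∣ U ∩ Z ∣ ≤ ∣ U ∩ X ∣)
      sizes {Z} Z∈ = +-≡⇒≤⇔≥ (trans (∣∩∣+∣∁∩∣≡size U X)
                               (trans (bases-equicardinal M bX (∈-bases⁻ Z∈)) (sym (∣∩∣+∣∁∩∣≡size U Z))))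

  sum-homog-bases : (m : Subset n → Mono n) (K : ℕ) (g : ℚ × Mono n → ℚ) →
                    (∀ X → IsBasis M X → (deg (m X) ≡ K) ⇔ MaximallyMeets M U X) →
                    sumOver (homog K (monomials m bases)) g ≡ sumSubsets n (λ X → when (F X) (g (1ℚ , m X)))
  sum-homog-bases m K g ≡K⇔ =
    trans (sumOver-homog-monomials m K bases g)
   (trans (sumOver-filter (λ B → T? (isBasis M B)) (subsets n) _)
          (sumOver-cong (subsets n) (λ X → when-basis X (deg (m X) ℕ.≟ K) _ (≡K⇔ X))))

  coeff-basisPoly : ∀ α → coeff (basisPoly F) α ≡ sumSubsets n (λ B → when (F B) (contribution (χ B) α 1ℚ))
  coeff-basisPoly α =
    trans (coeff-monomials χ (filter (λ B → T? (F B)) (subsets n)) α) (sumOver-filter (λ B → T? (F B)) (subsets n) _)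

  coeff-low·top : ∀ c α →
    coeff (scale c (low (subst1 (∁ (outsideU U)) (h M)) ·P top (subst1 (outsideU U) (h M)))) α ≡
    sumSubsets n (λ X₁ → when (F X₁) (sumSubsets n (λ X₂ → when (F X₂) (contribution (χ (splice U X₁ X₂)) α (c ℚ.* (1ℚ ℚ.* 1ℚ))))))
  coeff-low·top c α with low-part | top-part
  ... | K₁ , low≡ , ≡K₁⇔ | K₂ , top≡ , ≡K₂⇔ = begin
    coeff (scale c (low P₁ ·P top P₂)) α                                      ≡⟨ cong₂ (λ p q → coeff (scale c (p ·P q)) α) low≡ top≡ ⟩
    coeff (scale c (H₁ ·P H₂)) α                                              ≡⟨ coeff-scale-·P c H₁ H₂ α ⟩
    sumOver H₁ (λ t → sumOver H₂ (λ s → term t s))                            ≡⟨ sum-homog-bases m₁ K₁ _ ≡K₁⇔ ⟩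
    sumSubsets n (λ X₁ → when (F X₁) (sumOver H₂ (λ s → term (1ℚ , m₁ X₁) s))) ≡⟨ sumOver-cong (subsets n) (λ X₁ →
                                                                                   cong (when (F X₁)) (sum-homog-bases m₂ K₂ _ ≡K₂⇔)) ⟩
    sumSubsets n (λ X₁ → when (F X₁) (sumSubsets n (λ X₂ → when (F X₂) (term (1ℚ , m₁ X₁) (1ℚ , m₂ X₂)))))
                                                                              ≡⟨ sumOver-cong (subsets n) (λ X₁ → cong (when (F X₁))
                                                                                   (sumOver-cong (subsets n) (λ X₂ → cong (λ β → when (F X₂)
                                                                                     (contribution β α (c ℚ.* (1ℚ ℚ.* 1ℚ)))) (mask-+-mask U X₁ X₂)))) ⟩
    sumSubsets n (λ X₁ → when (F X₁) (sumSubsets n (λ X₂ → when (F X₂) (contribution (χ (splice U X₁ X₂)) α (c ℚ.* (1ℚ ℚ.* 1ℚ)))))) ∎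
    where
    open ≡-Reasoning
    P₁ P₂ H₁ H₂ : Poly n
    m₁ m₂ : Subset n → Mono n
    P₁ = subst1 (∁ (outsideU U)) (h M)
    P₂ = subst1 (outsideU U) (h M)
    m₁ = mask (∁ (outsideU U)) ∘ χ
    m₂ = mask (outsideU U) ∘ χ
    H₁ = homog K₁ (monomials m₁ bases)
    H₂ = homog K₂ (monomials m₂ bases)
    term : ℚ × Mono n → ℚ × Mono n → ℚ
    term t s = contribution (zipWith _+_ (proj₂ t) (proj₂ s)) α (c ℚ.* (proj₁ t ℚ.* proj₁ s))

  Γ : Subset n → Subset n → Subset n → Bool
  Γ B X₁ X₂ = F X₁ ∧ (F X₂ ∧ does (splice U X₁ X₂ ≟ˢ B))

  fibre : Subset n → ℚ
  fibre B = sumSubsets n (λ X₁ → sumSubsets n (λ X₂ → iversonℚ (Γ B X₁ X₂)))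

  sum-over-splices : (φ : Subset n → ℚ) →
    sumSubsets n (λ X₁ → when (F X₁) (sumSubsets n (λ X₂ → when (F X₂) (φ (splice U X₁ X₂))))) ≡
    sumSubsets n (λ B → fibre B ℚ.* φ B)
  sum-over-splices φ = begin
    ∑ (λ X₁ → when (F X₁) (∑ (λ X₂ → when (F X₂) (φ (splice U X₁ X₂)))))
      ≡⟨ ∑-cong (λ X₁ → cong (when (F X₁)) (∑-cong (λ X₂ → cong (when (F X₂)) (sumSubsets-δ n (splice U X₁ X₂) φ)))) ⟨
    ∑ (λ X₁ → when (F X₁) (∑ (λ X₂ → when (F X₂) (∑ (λ B → when (does (splice U X₁ X₂ ≟ˢ B)) (φ B))))))
      ≡⟨ ∑-cong (λ X₁ → trans (sumOver-when (subsets n) (F X₁) _) (∑-cong (λ X₂ →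
           trans (cong (when (F X₁)) (sumOver-when (subsets n) (F X₂) _)) (sumOver-when (subsets n) (F X₁) _)))) ⟩
    ∑ (λ X₁ → ∑ (λ X₂ → ∑ (λ B → when (F X₁) (when (F X₂) (when (does (splice U X₁ X₂ ≟ˢ B)) (φ B))))))
      ≡⟨ ∑-cong (λ X₁ → ∑-cong (λ X₂ → ∑-cong (λ B → when-when (F X₁) (F X₂) _ (φ B)))) ⟩
    ∑ (λ X₁ → ∑ (λ X₂ → ∑ (λ B → iversonℚ (Γ B X₁ X₂) ℚ.* φ B)))
      ≡⟨ ∑-cong (λ X₁ → sumOver-comm (subsets n) (subsets n) _) ⟩
    ∑ (λ X₁ → ∑ (λ B → ∑ (λ X₂ → iversonℚ (Γ B X₁ X₂) ℚ.* φ B)))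
      ≡⟨ sumOver-comm (subsets n) (subsets n) _ ⟩
    ∑ (λ B → ∑ (λ X₁ → ∑ (λ X₂ → iversonℚ (Γ B X₁ X₂) ℚ.* φ B)))
      ≡⟨ ∑-cong (λ B → trans (∑-cong (λ X₁ → sym (sumOver-*ʳ (subsets n) _ (φ B)))) (sym (sumOver-*ʳ (subsets n) _ (φ B)))) ⟩
    ∑ (λ B → fibre B ℚ.* φ B) ∎
    where
    open ≡-Reasoning
    ∑ : (Subset n → ℚ) → ℚ
    ∑ = sumSubsets n
    ∑-cong : {f g : Subset n → ℚ} → (∀ X → f X ≡ g X) → ∑ f ≡ ∑ g
    ∑-cong = sumOver-cong (subsets n)

  fibre-outside : ∀ B → F B ≡ false → fibre B ≡ 0ℚ
  fibre-outside B FB = sumOver-zero (subsets n) λ X₁ → sumOver-zero (subsets n) λ X₂ → cong iversonℚ (Γ≡false X₁ X₂)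
    where
    Γ≡false : ∀ X₁ X₂ → Γ B X₁ X₂ ≡ false
    Γ≡false X₁ X₂ with F X₁ in F₁ | F X₂ in F₂ | splice U X₁ X₂ ≟ˢ B
    ... | false | _     | _       = refl
    ... | true  | false | _       = refl
    ... | true  | true  | no  _   = refl
    ... | true  | true  | yes s≡B = contradiction FB (BoolP.not-¬ (trans (sym (cong F s≡B)) (F-splice F₁ F₂)))

  fibre-inside : ∀ B → F B ≡ true → fibre B ≡ fibre B₀
  fibre-inside B FB = begin
    fibre B                                                          ≡⟨ sumSubsets-⊕ n m₁ _ ⟨
    ∑ (λ X₁ → ∑ (λ X₂ → iversonℚ (Γ B (m₁ ⊕ X₁) X₂)))                 ≡⟨ sumOver-cong (subsets n) (λ X₁ → sumSubsets-⊕ n m₂ _) ⟨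
    ∑ (λ X₁ → ∑ (λ X₂ → iversonℚ (Γ B (m₁ ⊕ X₁) (m₂ ⊕ X₂))))          ≡⟨ sumOver-cong (subsets n) (λ X₁ →
                                                                          sumOver-cong (subsets n) (λ X₂ → cong iversonℚ (Γ-shift X₁ X₂))) ⟩
    fibre B₀                                                         ∎
    where
    -- Translating X₁ by B ⊕ B₀ outside U and X₂ by B ⊕ B₀ inside U matches the pairs splicing
    -- to B with those splicing to B₀.
    open ≡-Reasoning
    ∑ : (Subset n → ℚ) → ℚ
    ∑ = sumSubsets n
    D m₁ m₂ : Subset n
    D = B ⊕ B₀
    m₁ = splice U D ∅
    m₂ = splice U ∅ D
    does-shift : ∀ X₁ X₂ → does (splice U (m₁ ⊕ X₁) (m₂ ⊕ X₂) ≟ˢ B) ≡ does (splice U X₁ X₂ ≟ˢ B₀)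
    does-shift X₁ X₂ =
      trans (cong₂ (λ Y Z → does (Y ≟ˢ Z)) (splice-⊕ U D X₁ X₂) (sym (⊕-cancelʳ B B₀))) (does-⊕ D (splice U X₁ X₂) B₀)
    F-⇔ : ∀ {X Y} → (F X ≡ true → F Y ≡ true) → (F Y ≡ true → F X ≡ true) → F X ≡ F Y
    F-⇔ X⇒Y Y⇒X = BoolP.⇔→≡ {z = true} (mk⇔ X⇒Y Y⇒X)
    F-shift₁ : ∀ X₁ X₂ → splice U X₁ X₂ ≡ B₀ → F (m₁ ⊕ X₁) ≡ F X₁
    F-shift₁ X₁ X₂ e = F-⇔
      (λ F₁′ → subst (λ Z → F Z ≡ true) (sym (subst (λ Z → X₁ ≡ splice U Z (splice U (B ⊕ Z) ∅ ⊕ X₁)) e (splice-⊕-outside U B X₁ X₂)))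
                     (F-splice F-B₀ F₁′))
      (λ F₁ → subst (λ Z → F Z ≡ true) (sym (subst (λ Z → splice U (B ⊕ Z) ∅ ⊕ X₁ ≡ splice U B X₁) e (⊕-splice-outside U B X₁ X₂)))
                    (F-splice FB F₁))
    F-shift₂ : ∀ X₁ X₂ → splice U X₁ X₂ ≡ B₀ → F (m₂ ⊕ X₂) ≡ F X₂
    F-shift₂ X₁ X₂ e = F-⇔
      (λ F₂′ → subst (λ Z → F Z ≡ true) (sym (subst (λ Z → X₂ ≡ splice U (splice U ∅ (B ⊕ Z) ⊕ X₂) Z) e (splice-⊕-inside U B X₁ X₂)))
                     (F-splice F₂′ F-B₀))
      (λ F₂ → subst (λ Z → F Z ≡ true) (sym (subst (λ Z → splice U ∅ (B ⊕ Z) ⊕ X₂ ≡ splice U X₂ B) e (⊕-splice-inside U B X₁ X₂)))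
                    (F-splice F₂ FB))
    Γ-shift : ∀ X₁ X₂ → Γ B (m₁ ⊕ X₁) (m₂ ⊕ X₂) ≡ Γ B₀ X₁ X₂
    Γ-shift X₁ X₂ = trans (cong (λ b → F (m₁ ⊕ X₁) ∧ (F (m₂ ⊕ X₂) ∧ b)) (does-shift X₁ X₂)) (agree (splice U X₁ X₂ ≟ˢ B₀))
      where
      agree : (d : Dec (splice U X₁ X₂ ≡ B₀)) → F (m₁ ⊕ X₁) ∧ (F (m₂ ⊕ X₂) ∧ does d) ≡ F X₁ ∧ (F X₂ ∧ does d)
      agree (yes e) = cong₂ (λ a b → a ∧ (b ∧ true)) (F-shift₁ X₁ X₂ e) (F-shift₂ X₁ X₂ e)
      agree (no  _) = trans (cong (F (m₁ ⊕ X₁) ∧_) (BoolP.∧-zeroʳ _))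
                     (trans (BoolP.∧-zeroʳ _) (sym (trans (cong (F X₁ ∧_) (BoolP.∧-zeroʳ _)) (BoolP.∧-zeroʳ _))))

  fibre-B₀-≥1 : 1ℚ ℚ.≤ fibre B₀
  fibre-B₀-≥1 = begin
    1ℚ                                       ≡⟨ cong iversonℚ Γ-B₀ ⟨
    iversonℚ (Γ B₀ B₀ B₀)                    ≤⟨ sumOver-≥ (λ X₂ → iversonℚ≥0 _) (∈-subsets B₀) ⟩
    sumSubsets n (λ X₂ → iversonℚ (Γ B₀ B₀ X₂)) ≤⟨ sumOver-≥ (λ X₁ → sumOver-nonneg (subsets n) (λ X₂ → iversonℚ≥0 _)) (∈-subsets B₀) ⟩
    fibre B₀                                 ∎
    where
    open ℚP.≤-Reasoning
    iversonℚ≥0 : ∀ b → 0ℚ ℚ.≤ iversonℚ b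
    iversonℚ≥0 true  = ℚP.<⇒≤ (ℚP.positive⁻¹ 1ℚ)
    iversonℚ≥0 false = ℚP.≤-refl
    Γ-B₀ : Γ B₀ B₀ B₀ ≡ true
    Γ-B₀ = cong₂ (λ a b → a ∧ (a ∧ b)) F-B₀ (dec-true (splice U B₀ B₀ ≟ˢ B₀) (splice-idem U B₀))

  basisPoly-factorises : ∃[ c ] basisPoly F ≈P scale c (low (subst1 (∁ (outsideU U)) (h M)) ·P top (subst1 (outsideU U) (h M)))
  basisPoly-factorises = c , λ α → begin
    coeff (basisPoly F) α                                                 ≡⟨ coeff-basisPoly α ⟩
    sumSubsets n (λ B → when (F B) (contribution (χ B) α 1ℚ))              ≡⟨ sumOver-cong (subsets n) (weight α) ⟨
    sumSubsets n (λ B → fibre B ℚ.* contribution (χ B) α v)                ≡⟨ sum-over-splices (λ B → contribution (χ B) α v) ⟨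
    sumSubsets n (λ X₁ → when (F X₁) (sumSubsets n (λ X₂ → when (F X₂) (contribution (χ (splice U X₁ X₂)) α v))))
                                                                          ≡⟨ coeff-low·top c α ⟨
    coeff (scale c (low (subst1 (∁ (outsideU U)) (h M)) ·P top (subst1 (outsideU U) (h M)))) α ∎
    where
    open ≡-Reasoning
    N≢0 : fibre B₀ ≢ 0ℚ
    N≢0 N≡0 = ℚP.<-irrefl refl (ℚP.<-≤-trans (ℚP.positive⁻¹ 1ℚ) (subst (1ℚ ℚ.≤_) N≡0 fibre-B₀-≥1))
    instance _ = ℚ.≢-nonZero N≢0
    c v : ℚ
    c = ℚ.1/ fibre B₀
    v = c ℚ.* (1ℚ ℚ.* 1ℚ)
    N*v≡1 : fibre B₀ ℚ.* v ≡ 1ℚ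
    N*v≡1 = trans (cong (fibre B₀ ℚ.*_) (trans (cong (c ℚ.*_) (ℚP.*-identityˡ 1ℚ)) (ℚP.*-identityʳ c))) (ℚP.*-inverseʳ (fibre B₀))
    weight : ∀ α B → fibre B ℚ.* contribution (χ B) α v ≡ when (F B) (contribution (χ B) α 1ℚ)
    weight α B with F B in FB
    ... | true  = trans (cong (ℚ._* contribution (χ B) α v) (fibre-inside B FB))
                        (trans (contribution-*ˡ (χ B) α (fibre B₀) v) (cong (contribution (χ B) α) N*v≡1))
    ... | false = trans (cong (ℚ._* contribution (χ B) α v) (fibre-outside B FB)) (ℚP.*-zeroˡ (contribution (χ B) α v))

corollary4p5 : ∀ (n : ℕ) (M : Matroid n) (w : Fin n → ℚ) → IsFacet M w →
    ∃[ S ] ∃[ c ] (hFace M w ≈P scale c (low (subst1 (∁ S) (h M)) ·P top (subst1 S (h M))))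
corollary4p5 n M w facet = outsideU level , LevelMaximal.basisPoly-factorises M level (isBasisFace M w) face⇔ B₀ F-B₀
  where
  open LevelSetDescription (facet⇒level-set-description M w facet)
  face⇔ : ∀ X → (isBasisFace M w X ≡ true) ⇔ (IsBasis M X × MaximallyMeets M level X)
  face⇔ X = mk⇔
    (λ FX → let (bX , mX) = face-basis⁻ M w X (Equivalence.from BoolP.T-≡ FX)
            in bX , maximiser-maximally-meets M w upper X bX mX)
    (λ (bX , X-max) → Equivalence.to BoolP.T-≡ (face-basis⁺ M w X bX (meets⇒maximal X bX X-max)))
  F-B₀ : isBasisFace M w B₀ ≡ true
  F-B₀ = Equivalence.to BoolP.T-≡ (face-basis⁺ M w B₀ B₀-basis B₀-maximiser)
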